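{- For every connected hypergraph $G$ and every hypergraph $H$, $$\mathsf{LoInjInHom}(G,H)=\sum_{G'}\mathsf{LeafAddInHom}(G,G')\cdot\mathsf{Aut}(G')^{ -1}\cdot\mathsf{LoInjHom}(G',H),$$ where $G'$ ranges over a fixed set of representatives of the isomorphism classes of connected hypergraphs (the sum having only finitely many non-zero terms). Moreover, the matrix $\mathsf{LeafAddInHom}$, indexed by these representatives ordered by $|V|+|E|$ (ties broken arbitrarily), is upper triangular and invertible.
   Context: All structures are finite. A hypergraph is a triple $G=(V,E,f)$ with vertex set $V(G)$, edge set $E(G)$ and incidence function $f_G\colon E(G)\to\mathcal{P}(V(G))\setminus\{\emptyset\}$; parallel edges are allowed. $G$ is connected if its incidence graph (bipartite graph on $V(G)\,\dot\cup\,E(G)$ with edges $ve$ for $v\in f_G(e)$) is connected. A leaf of $H$ is a vertex contained in exactly one edge. An incidence homomorphism from $G$ to $H$ is a pair $(h_V,h_E)$, $h_V\colon V(G)\to V(H)$, $h_E\colon E(G)\to E(H)$, with $h_V(f_G(e))\subseteq f_H(h_E(e))$ for all $e$; it is a homomorphism if equality always holds; it is locally injective if the restriction of $h_V$ to each $f_G(e)$ is injective; it is strong if $h_V^{ -1}(f_H(h_E(e))\cap h_V(V(G)))\subseteq f_G(e)$ for every $e\in E(G)$. It is leaf-adding if it is strong, $h_V$ is injective, $h_E$ is bijective, and every vertex in $V(H)\setminus h_V(V(G))$ is a leaf of $H$. $\mathsf{LoInjInHom}(G,H)$, $\mathsf{LoInjHom}(G,H)$ and $\mathsf{LeafAddInHom}(G,H)$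 (for connected $G,H$) count locally injective incidence homomorphisms, locally injective homomorphisms and leaf-adding incidence homomorphisms from $G$ to $H$, respectively. $\mathsf{Aut}(G')$ is the number of automorphisms of $G'$. An infinite matrix $A$ indexed by an ordered set is upper triangular if $A_{ij}=0$ whenever $i\not\le j$; invertible means it has an inverse. -}

module Defs where

open import Function using (_∘_)
open import Data.Nat as ℕ using (ℕ; zero; suc; _+_; _<_; _≤_)
open import Data.Integer using (+_)
open import Data.Rational as ℚ using (ℚ; 0ℚ; 1ℚ)
open import Data.Bool using (Bool; true; false; _∧_; _∨_; not; if_then_else_)
open import Data.Fin as Fin using (Fin; zero; suc)
open import Data.Fin.Subset using (Subset; Nonempty)
open import Data.Vec as Vec using ()
open import Data.Vec.Functional as VF using ()
open import Data.Nat.ListAction using (sum)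
open import Data.List as List using (List; []; _∷_; map; concatMap; length; allFin; lookup)
open import Data.Sum using (_⊎_; inj₁; inj₂)
open import Data.Product using (Σ; ∃; ∃₂; _×_; _,_; proj₁; proj₂)
open import Relation.Nullary using (does)
open import Relation.Binary.PropositionalEquality using (_≡_; _≢_)
open import Relation.Binary.Construct.Closure.ReflexiveTransitive using (Star)

-- Finite hypergraphs: V(G) = Fin nV, E(G) = Fin nE,
-- f_G(e) = inc e (a subset of Fin nV), required to be nonempty.
-- Parallel edges are allowed (inc need not be injective).

record Hypergraph : Set where
  constructor hyp
  field
    nV       : ℕ
    nE       : ℕ
    inc      : Fin nE → Subset nV
    nonempty : ∀ e → Nonempty (inc e)

open Hypergraph public

mem : (G : Hypergraph) → Fin (nE G) → Fin (nV G) → Bool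
mem G e v = Vec.lookup (inc G e) v

size : Hypergraph → ℕ
size G = nV G + nE G

-- Connectivity: the incidence graph on V ⊎ E is connected
-- (any two nodes are joined by a path).

Node : Hypergraph → Set
Node G = Fin (nV G) ⊎ Fin (nE G)

data IncAdj (G : Hypergraph) : Node G → Node G → Set where
  v-e : ∀ {v e} → mem G e v ≡ true → IncAdj G (inj₁ v) (inj₂ e)
  e-v : ∀ {v e} → mem G e v ≡ true → IncAdj G (inj₂ e) (inj₁ v)

Connected : Hypergraph → Set
Connected G = ∀ (x y : Node G) → Star (IncAdj G) x y

allᵇ : (n : ℕ) → (Fin n → Bool) → Bool
allᵇ zero    p = true
allᵇ (suc n) p = p zero ∧ allᵇ n (p ∘ suc)

anyᵇ : (n : ℕ) → (Fin n → Bool) → Bool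
anyᵇ zero    p = false
anyᵇ (suc n) p = p zero ∨ anyᵇ n (p ∘ suc)

countᵇ : (n : ℕ) → (Fin n → Bool) → ℕ
countᵇ zero    p = 0
countᵇ (suc n) p = (if p zero then 1 else 0) + countᵇ n (p ∘ suc)

infixr 4 _⇒ᵇ_
_⇒ᵇ_ : Bool → Bool → Bool
a ⇒ᵇ b = not a ∨ b

_⇔ᵇ_ : Bool → Bool → Bool
a ⇔ᵇ b = (a ⇒ᵇ b) ∧ (b ⇒ᵇ a)

eqᶠ : ∀ {n} → Fin n → Fin n → Bool
eqᶠ x y = does (x Fin.≟ y)

injᵇ : ∀ {a b} → (Fin a → Fin b) → Bool
injᵇ {a} h = allᵇ a λ x → allᵇ a λ y → eqᶠ (h x) (h y) ⇒ᵇ eqᶠ x y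

surjᵇ : ∀ {a b} → (Fin a → Fin b) → Bool
surjᵇ {a} {b} h = allᵇ b λ y → anyᵇ a λ x → eqᶠ (h x) y

VMap EMap : Hypergraph → Hypergraph → Set
VMap G H = Fin (nV G) → Fin (nV H)
EMap G H = Fin (nE G) → Fin (nE H)

module _ (G H : Hypergraph) (hV : VMap G H) (hE : EMap G H) where

  isInHom : Bool
  isInHom = allᵇ (nE G) λ e → allᵇ (nV G) λ v → mem G e v ⇒ᵇ mem H (hE e) (hV v)

  -- f_H(h_E(e)) ⊆ h_V(f_G(e))  (so together with isInHom: equality)
  isOnto : Bool
  isOnto = allᵇ (nE G) λ e → allᵇ (nV H) λ w →
             mem H (hE e) w ⇒ᵇ (anyᵇ (nV G) λ v → mem G e v ∧ eqᶠ (hV v) w)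

  isHom : Bool
  isHom = isInHom ∧ isOnto

  isLocInj : Bool
  isLocInj = allᵇ (nE G) λ e → allᵇ (nV G) λ v → allᵇ (nV G) λ v' →
               (mem G e v ∧ mem G e v' ∧ eqᶠ (hV v) (hV v')) ⇒ᵇ eqᶠ v v'

  -- h_V^{-1}(f_H(h_E(e)) ∩ h_V(V(G))) ⊆ f_G(e)
  isStrong : Bool
  isStrong = allᵇ (nE G) λ e → allᵇ (nV G) λ v → mem H (hE e) (hV v) ⇒ᵇ mem G e v

  isLeafAdding : Bool
  isLeafAdding = isStrong ∧ injᵇ hV ∧ injᵇ hE ∧ surjᵇ hE ∧
    (allᵇ (nV H) λ w → not (anyᵇ (nV G) λ v → eqᶠ (hV v) w) ⇒ᵇ
                        ℕ._≡ᵇ_ (countᵇ (nE H) λ e → mem H e w) 1)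

  isIso : Bool
  isIso = injᵇ hV ∧ surjᵇ hV ∧ injᵇ hE ∧ surjᵇ hE ∧
    (allᵇ (nE G) λ e → allᵇ (nV G) λ v → mem G e v ⇔ᵇ mem H (hE e) (hV v))

allFuns : (a b : ℕ) → List (Fin a → Fin b)
allFuns zero    b = VF.[] ∷ []
allFuns (suc a) b = concatMap (λ x → map (λ g → x VF.∷ g) (allFuns a b)) (allFin b)

count : (G H : Hypergraph) → (VMap G H → EMap G H → Bool) → ℕ
count G H P = sum (map (λ hV → sum (map (λ hE → if P hV hE then 1 else 0)
                  (allFuns (nE G) (nE H)))) (allFuns (nV G) (nV H)))

LoInjInHom : Hypergraph → Hypergraph → ℕ
LoInjInHom G H = count G H λ hV hE → isInHom G H hV hE ∧ isLocInj G H hV hE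

LoInjHom : Hypergraph → Hypergraph → ℕ
LoInjHom G H = count G H λ hV hE → isHom G H hV hE ∧ isLocInj G H hV hE

LeafAddInHom : Hypergraph → Hypergraph → ℕ
LeafAddInHom G H = count G H λ hV hE → isInHom G H hV hE ∧ isLeafAdding G H hV hE

Aut : Hypergraph → ℕ
Aut G = count G G (isIso G G)

Iso : Hypergraph → Hypergraph → Set
Iso G H = ∃₂ λ (hV : VMap G H) (hE : EMap G H) → isIso G H hV hE ≡ true

record RepSystem : Set₁ where
  field
    reps     : ℕ → List Hypergraph
    reps-size : ∀ k (i : Fin (length (reps k))) → size (lookup (reps k) i) ≡ k
    reps-conn : ∀ k (i : Fin (length (reps k))) → Connected (lookup (reps k) i)
    reps-complete : ∀ G → Connected G →
      Σ ℕ λ k → Σ (Fin (length (reps k))) λ i → Iso G (lookup (reps k) i)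
    reps-distinct : ∀ k l (i : Fin (length (reps k))) (j : Fin (length (reps l))) →
      Iso (lookup (reps k) i) (lookup (reps l) j) → Σ (k ≡ l) λ { _≡_.refl → i ≡ j }

open RepSystem public

Index : RepSystem → Set
Index R = Σ ℕ λ k → Fin (length (reps R k))

rep : (R : RepSystem) → Index R → Hypergraph
rep R (k , i) = lookup (reps R k) i

level : {R : RepSystem} → Index R → ℕ
level = proj₁

toℚ : ℕ → ℚ
toℚ n = + n ℚ./ 1

-- 1/n for n ≥ 1 (only used on Aut, which is ≥ 1 because of the identity)
invℕ : ℕ → ℚ
invℕ zero    = 0ℚ
invℕ (suc n) = + 1 ℚ./ suc n

sumℚ : List ℚ → ℚ
sumℚ = List.foldr ℚ._+_ 0ℚ

sumBelow : (R : RepSystem) → ℕ → (Index R → ℚ) → ℚ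
sumBelow R zero    F = 0ℚ
sumBelow R (suc N) F = sumBelow R N F ℚ.+ sumℚ (map (λ i → F (N , i)) (allFin (length (reps R N))))

term : (R : RepSystem) → Hypergraph → Hypergraph → Index R → ℚ
term R G H a = toℚ (LeafAddInHom G (rep R a)) ℚ.* invℕ (Aut (rep R a)) ℚ.* toℚ (LoInjHom (rep R a) H)

LA : (R : RepSystem) → Index R → Index R → ℚ
LA R a b = toℚ (LeafAddInHom (rep R a) (rep R b))

-- upper triangular w.r.t. the order by |V|+|E| with ties broken arbitrarily:
-- an entry at (a,b) may be non-zero only if a = b or level a < level b
-- (this is "upper triangular for every tie-breaking")
UpperTriangular : (R : RepSystem) → (Index R → Index R → ℚ) → Set
UpperTriangular R M = ∀ a b → M a b ≢ 0ℚ → a ≡ b ⊎ level {R} a < level {R} b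

-- matrix product; for upper triangular M, N the full (infinite) sum over c
-- reduces to the finite sum over c with level c ≤ level b
mul : (R : RepSystem) → (Index R → Index R → ℚ) → (Index R → Index R → ℚ) → Index R → Index R → ℚ
mul R M N a b = sumBelow R (suc (level {R} b)) λ c → M a c ℚ.* N c b

IsIdentity : (R : RepSystem) → (Index R → Index R → ℚ) → Set
IsIdentity R M = (∀ a → M a a ≡ 1ℚ) × (∀ a b → a ≢ b → M a b ≡ 0ℚ)

Invertible : (R : RepSystem) → (Index R → Index R → ℚ) → Set
Invertible R M = Σ (Index R → Index R → ℚ) λ N →
  UpperTriangular R N × IsIdentity R (mul R M N) × IsIdentity R (mul R N M)

-- Every locally injective incidence homomorphism h : G → H factors as k ∘ g with g : G → G′
-- leaf-adding and k : G′ → H a locally injective homomorphism: G′ is G with one new leaf for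
-- every vertex of an edge h_E e that h_V misses on e.  Such a factorisation is unique up to a
-- unique isomorphism of the middle hypergraph.  Hence, for a representative A, the pairs
-- (g , k) with k ∘ g = h are either absent or exactly Aut(A) many, and there is exactly one A
-- for which they exist; counting all pairs (g , k) gives
--   LeafAddInHom(G,A) · LoInjHom(A,H) = Aut(A) · #{h factoring through A},
-- and summing over A gives the identity.  Since |V(G′)| ≤ |V(G)| + |E(G)|·|V(H)|, only
-- finitely many A contribute.
--
-- A leaf-adding map is bijective on edges and injective on vertices, so LeafAddInHom(A,B) ≠ 0
-- forces A ≅ B or |V(A)|+|E(A)| < |V(B)|+|E(B)|, and LeafAddInHom(A,A) ≥ 1: the matrix is
-- upper triangular with non-zero diagonal, and back substitution inverts it.

module Submission where

open import Defs
open import Algebra.Bundles using (CommutativeSemigroup)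
open import Algebra.Core using (Op₂)
open import Algebra.Structures using (IsCommutativeSemiring; IsCommutativeRing)
open import Data.Bool as Bool using (Bool; true; false; _∧_; not; if_then_else_)
open import Data.Empty using (⊥-elim)
open import Data.Fin as Fin using (Fin; zero; suc; _↑ˡ_; _↑ʳ_; splitAt)
open import Data.Fin.Properties as FP using ()
open import Data.Fin.Subset using (Nonempty)
open import Data.Integer as ℤ using ()
open import Data.Integer.Properties as ℤP using ()
open import Data.List using (List; []; _∷_; map; foldr; concatMap; _++_; allFin; length; cartesianProduct)
open import Data.List.Properties as LP using ()
open import Data.Nat as ℕ using (ℕ; zero; suc; _+_; _*_; _<_; _≤_; z≤n; s≤s)
open import Data.Nat.Coprimality as Cop using ()
open import Data.Nat.Properties as ℕP using ()
open import Data.Product using (Σ; ∃; _×_; _,_; proj₁; proj₂)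
open import Data.Rational as ℚ using (ℚ; 0ℚ; 1ℚ)
open import Data.Rational.Properties as ℚP using ()
open import Data.Rational.Solver using () renaming (module +-*-Solver to ℚSolver)
open import Data.Sum as Sum using (_⊎_; inj₁; inj₂; [_,_]′)
open import Data.Unit using (tt)
open import Data.Vec as Vec using ()
open import Data.Vec.Functional as VF using ()
open import Data.Vec.Properties as VP using ()
open import Function using (_∘_; id)
open import Function.Definitions using (Injective; StrictlySurjective)
open import Level using (0ℓ)
open import Relation.Binary.Construct.Closure.ReflexiveTransitive as Star using (Star; _◅_; _◅◅_; gmap)
open import Relation.Binary.Definitions using (tri<; tri≈; tri>)
open import Relation.Binary.PropositionalEquality
open import Relation.Nullary using (¬_; Dec; yes; no)

module ListSum {A : Set} {_+_ _*_ : Op₂ A} {0# 1# : A}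
               (isCS : IsCommutativeSemiring _≡_ _+_ _*_ 0# 1#) where
  open IsCommutativeSemiring isCS
    using (+-assoc; +-identityˡ; +-identityʳ; zeroˡ; zeroʳ; distribˡ; distribʳ; +-isCommutativeSemigroup)

  private
    +-commutativeSemigroup : CommutativeSemigroup 0ℓ 0ℓ
    +-commutativeSemigroup = record { isCommutativeSemigroup = +-isCommutativeSemigroup }

  open import Algebra.Properties.CommutativeSemigroup +-commutativeSemigroup using (interchange)

  private variable X Y : Set

  ∑ : List X → (X → A) → A
  ∑ xs f = foldr _+_ 0# (map f xs)

  ∑-cong : (xs : List X) {f g : X → A} → (∀ x → f x ≡ g x) → ∑ xs f ≡ ∑ xs g
  ∑-cong []       e = refl
  ∑-cong (x ∷ xs) e = cong₂ _+_ (e x) (∑-cong xs e)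

  ∑-zero : (xs : List X) (f : X → A) → (∀ x → f x ≡ 0#) → ∑ xs f ≡ 0#
  ∑-zero []       f z = refl
  ∑-zero (x ∷ xs) f z = trans (cong₂ _+_ (z x) (∑-zero xs f z)) (+-identityˡ 0#)

  ∑-distrib-+ : (xs : List X) (f g : X → A) → ∑ xs (λ x → f x + g x) ≡ ∑ xs f + ∑ xs g
  ∑-distrib-+ []       f g = sym (+-identityˡ 0#)
  ∑-distrib-+ (x ∷ xs) f g =
    trans (cong ((f x + g x) +_) (∑-distrib-+ xs f g)) (interchange (f x) (g x) (∑ xs f) (∑ xs g))

  ∑-*ˡ : (xs : List X) (c : A) (f : X → A) → ∑ xs (λ x → c * f x) ≡ c * ∑ xs f
  ∑-*ˡ []       c f = sym (zeroʳ c)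
  ∑-*ˡ (x ∷ xs) c f = trans (cong ((c * f x) +_) (∑-*ˡ xs c f)) (sym (distribˡ c (f x) (∑ xs f)))

  ∑-*ʳ : (xs : List X) (f : X → A) (c : A) → ∑ xs (λ x → f x * c) ≡ ∑ xs f * c
  ∑-*ʳ []       f c = sym (zeroˡ c)
  ∑-*ʳ (x ∷ xs) f c = trans (cong ((f x * c) +_) (∑-*ʳ xs f c)) (sym (distribʳ c (f x) (∑ xs f)))

  ∑-++ : (xs ys : List X) (f : X → A) → ∑ (xs ++ ys) f ≡ ∑ xs f + ∑ ys f
  ∑-++ []       ys f = sym (+-identityˡ (∑ ys f))
  ∑-++ (x ∷ xs) ys f = trans (cong (f x +_) (∑-++ xs ys f)) (sym (+-assoc (f x) (∑ xs f) (∑ ys f)))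

  ∑-swap : (xs : List X) (ys : List Y) (f : X → Y → A) →
    ∑ xs (λ x → ∑ ys (f x)) ≡ ∑ ys (λ y → ∑ xs (λ x → f x y))
  ∑-swap []       ys f = sym (∑-zero ys _ (λ _ → refl))
  ∑-swap (x ∷ xs) ys f = trans (cong (∑ ys (f x) +_) (∑-swap xs ys f))
                               (sym (∑-distrib-+ ys (f x) (λ y → ∑ xs (λ x → f x y))))

  ∑-map : (xs : List X) (g : X → Y) (f : Y → A) → ∑ (map g xs) f ≡ ∑ xs (f ∘ g)
  ∑-map []       g f = refl
  ∑-map (x ∷ xs) g f = cong (f (g x) +_) (∑-map xs g f)

  ∑-concatMap : (xs : List X) (g : X → List Y) (f : Y → A) →
    ∑ (concatMap g xs) f ≡ ∑ xs (λ x → ∑ (g x) f)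
  ∑-concatMap []       g f = refl
  ∑-concatMap (x ∷ xs) g f =
    trans (∑-++ (g x) (concatMap g xs) f) (cong (∑ (g x) f +_) (∑-concatMap xs g f))

  ∑-allFin-suc : ∀ n (f : Fin (suc n) → A) → ∑ (allFin (suc n)) f ≡ f zero + ∑ (allFin n) (f ∘ suc)
  ∑-allFin-suc n f = cong (f zero +_)
    (trans (cong (λ l → ∑ l f) (sym (LP.map-tabulate id suc))) (∑-map (allFin n) suc f))

  ∑-allFin-δ : ∀ n (f : Fin n → A) (i₀ : Fin n) → (∀ i → i ≢ i₀ → f i ≡ 0#) → ∑ (allFin n) f ≡ f i₀
  ∑-allFin-δ (suc n) f zero z = begin
      ∑ (allFin (suc n)) f
    ≡⟨ ∑-allFin-suc n f ⟩
      f zero + ∑ (allFin n) (f ∘ suc)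
    ≡⟨ cong (f zero +_) (∑-zero (allFin n) (f ∘ suc) (λ i → z (suc i) (λ ()))) ⟩
      f zero + 0#
    ≡⟨ +-identityʳ (f zero) ⟩
      f zero
    ∎
    where open ≡-Reasoning
  ∑-allFin-δ (suc n) f (suc i₀) z = begin
      ∑ (allFin (suc n)) f
    ≡⟨ ∑-allFin-suc n f ⟩
      f zero + ∑ (allFin n) (f ∘ suc)
    ≡⟨ cong (_+ ∑ (allFin n) (f ∘ suc)) (z zero (λ ())) ⟩
      0# + ∑ (allFin n) (f ∘ suc)
    ≡⟨ +-identityˡ _ ⟩
      ∑ (allFin n) (f ∘ suc)
    ≡⟨ ∑-allFin-δ n (f ∘ suc) i₀ (λ i i≢i₀ → z (suc i) (i≢i₀ ∘ FP.suc-injective)) ⟩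
      f (suc i₀)
    ∎
    where open ≡-Reasoning

  module Levels (R : RepSystem) where

    row : ℕ → (Index R → A) → A
    row n F = ∑ (allFin (length (reps R n))) (λ i → F (n , i))

    ∑< : ℕ → (Index R → A) → A
    ∑< zero    F = 0#
    ∑< (suc n) F = ∑< n F + row n F

    ∑<-cong : ∀ n {F G : Index R → A} → (∀ a → level {R} a < n → F a ≡ G a) → ∑< n F ≡ ∑< n G
    ∑<-cong zero    e = refl
    ∑<-cong (suc n) e = cong₂ _+_ (∑<-cong n (λ a a<n → e a (ℕP.m<n⇒m<1+n a<n)))
                                 (∑-cong (allFin _) (λ i → e (n , i) ℕP.≤-refl))

    ∑<-zero : ∀ n (F : Index R → A) → (∀ a → level {R} a < n → F a ≡ 0#) → ∑< n F ≡ 0#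
    ∑<-zero zero    F z = refl
    ∑<-zero (suc n) F z =
      trans (cong₂ _+_ (∑<-zero n F (λ a a<n → z a (ℕP.m<n⇒m<1+n a<n)))
                       (∑-zero (allFin _) (λ i → F (n , i)) (λ i → z (n , i) ℕP.≤-refl)))
            (+-identityˡ 0#)

    ∑<-distrib-+ : ∀ n (F G : Index R → A) → ∑< n (λ a → F a + G a) ≡ ∑< n F + ∑< n G
    ∑<-distrib-+ zero    F G = sym (+-identityˡ 0#)
    ∑<-distrib-+ (suc n) F G =
      trans (cong₂ _+_ (∑<-distrib-+ n F G) (∑-distrib-+ (allFin _) (λ i → F (n , i)) (λ i → G (n , i))))
            (interchange (∑< n F) (∑< n G) (row n F) (row n G))

    ∑<-*ˡ : ∀ n c (F : Index R → A) → ∑< n (λ a → c * F a) ≡ c * ∑< n F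
    ∑<-*ˡ zero    c F = sym (zeroʳ c)
    ∑<-*ˡ (suc n) c F = trans (cong₂ _+_ (∑<-*ˡ n c F) (∑-*ˡ (allFin _) c (λ i → F (n , i))))
                              (sym (distribˡ c (∑< n F) (row n F)))

    ∑<-*ʳ : ∀ n (F : Index R → A) c → ∑< n (λ a → F a * c) ≡ ∑< n F * c
    ∑<-*ʳ zero    F c = sym (zeroˡ c)
    ∑<-*ʳ (suc n) F c = trans (cong₂ _+_ (∑<-*ʳ n F c) (∑-*ʳ (allFin _) (λ i → F (n , i)) c))
                              (sym (distribʳ c (∑< n F) (row n F)))

    ∑<-∑-swap : ∀ n (xs : List X) (F : Index R → X → A) →
      ∑< n (λ a → ∑ xs (F a)) ≡ ∑ xs (λ x → ∑< n (λ a → F a x))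
    ∑<-∑-swap zero    xs F = sym (∑-zero xs _ (λ _ → refl))
    ∑<-∑-swap (suc n) xs F =
      trans (cong₂ _+_ (∑<-∑-swap n xs F) (∑-swap (allFin _) xs (λ i → F (n , i))))
            (sym (∑-distrib-+ xs (λ x → ∑< n (λ a → F a x)) (λ x → row n (λ a → F a x))))

    ∑<-swap : ∀ m n (F : Index R → Index R → A) →
      ∑< m (λ a → ∑< n (F a)) ≡ ∑< n (λ b → ∑< m (λ a → F a b))
    ∑<-swap m zero    F = ∑<-zero m _ (λ _ _ → refl)
    ∑<-swap m (suc n) F =
      trans (∑<-distrib-+ m (λ a → ∑< n (F a)) (λ a → row n (F a)))
            (cong₂ _+_ (∑<-swap m n F) (∑<-∑-swap m (allFin _) (λ a i → F a (n , i))))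

    ∑<-δ : ∀ n (F : Index R → A) a₀ → (∀ a → level {R} a < n → a ≢ a₀ → F a ≡ 0#) →
      level {R} a₀ < n → ∑< n F ≡ F a₀
    ∑<-δ (suc n) F (k , i₀) z a₀<n with n ℕ.≟ k
    ... | yes refl = begin
        ∑< n F + row n F
      ≡⟨ cong₂ _+_ (∑<-zero n F (λ a a<n → z a (ℕP.m<n⇒m<1+n a<n) (λ { refl → ℕP.<-irrefl refl a<n })))
                   (∑-allFin-δ _ (λ i → F (n , i)) i₀ (λ i i≢i₀ → z (n , i) ℕP.≤-refl (λ { refl → i≢i₀ refl }))) ⟩
        0# + F (n , i₀)
      ≡⟨ +-identityˡ _ ⟩
        F (n , i₀)
      ∎
      where open ≡-Reasoning
    ... | no n≢k = begin
        ∑< n F + row n F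
      ≡⟨ cong₂ _+_ (∑<-δ n F (k , i₀) (λ a a<n → z a (ℕP.m<n⇒m<1+n a<n)) (ℕP.≤∧≢⇒< (ℕP.≤-pred a₀<n) (n≢k ∘ sym)))
                   (∑-zero (allFin _) (λ i → F (n , i)) (λ i → z (n , i) ℕP.≤-refl (λ { refl → n≢k refl }))) ⟩
        F (k , i₀) + 0#
      ≡⟨ +-identityʳ _ ⟩
        F (k , i₀)
      ∎
      where open ≡-Reasoning

    ∑<-extend : ∀ m n (F : Index R → A) → m ≤ n → (∀ a → m ≤ level {R} a → level {R} a < n → F a ≡ 0#) →
      ∑< m F ≡ ∑< n F
    ∑<-extend zero zero    F _  _ = refl
    ∑<-extend m    (suc n) F m≤ z with ℕP.m≤n⇒m<n∨m≡n m≤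
    ... | inj₂ refl      = refl
    ... | inj₁ (s≤s m≤n) = begin
        ∑< m F
      ≡⟨ ∑<-extend m n F m≤n (λ a m≤a a<n → z a m≤a (ℕP.m<n⇒m<1+n a<n)) ⟩
        ∑< n F
      ≡⟨ sym (+-identityʳ _) ⟩
        ∑< n F + 0#
      ≡⟨ cong (∑< n F +_) (sym (∑-zero (allFin _) (λ i → F (n , i)) (λ i → z (n , i) m≤n ℕP.≤-refl))) ⟩
        ∑< n F + row n F
      ∎
      where open ≡-Reasoning

open ListSum ℕP.+-*-isCommutativeSemiring
module ℚΣ = ListSum (IsCommutativeRing.isCommutativeSemiring ℚP.+-*-isCommutativeRing)

Holds : Bool → Set
Holds b = b ≡ true

false⇒¬Holds : ∀ {a} → a ≡ false → ¬ Holds a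
false⇒¬Holds refl ()

Holds-ext : ∀ {a b} → (Holds a → Holds b) → (Holds b → Holds a) → a ≡ b
Holds-ext {true}           f g = sym (f refl)
Holds-ext {false} {true}   f g = g refl
Holds-ext {false} {false}  f g = refl

∧-projˡ : ∀ {a b} → Holds (a ∧ b) → Holds a
∧-projˡ {true} _ = refl

∧-projʳ : ∀ {a b} → Holds (a ∧ b) → Holds b
∧-projʳ {true} p = p

∧-intro : ∀ {a b} → Holds a → Holds b → Holds (a ∧ b)
∧-intro refl p = p

⇒ᵇ-elim : ∀ {a b} → Holds (a ⇒ᵇ b) → Holds a → Holds b
⇒ᵇ-elim {true} p refl = p

⇒ᵇ-intro : ∀ {a b} → (Holds a → Holds b) → Holds (a ⇒ᵇ b)
⇒ᵇ-intro {true}  f = f refl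
⇒ᵇ-intro {false} f = refl

⇔ᵇ-to : ∀ {a b} → Holds (a ⇔ᵇ b) → Holds a → Holds b
⇔ᵇ-to p = ⇒ᵇ-elim (∧-projˡ p)

⇔ᵇ-from : ∀ {a b} → Holds (a ⇔ᵇ b) → Holds b → Holds a
⇔ᵇ-from {a} {b} p = ⇒ᵇ-elim {b} {a} (∧-projʳ {a ⇒ᵇ b} p)

⇔ᵇ-intro : ∀ {a b} → (Holds a → Holds b) → (Holds b → Holds a) → Holds (a ⇔ᵇ b)
⇔ᵇ-intro f g = ∧-intro (⇒ᵇ-intro f) (⇒ᵇ-intro g)

not-intro : ∀ {a} → ¬ Holds a → Holds (not a)
not-intro {true}  f = ⊥-elim (f refl)
not-intro {false} f = refl

not-elim : ∀ {a} → Holds (not a) → ¬ Holds a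
not-elim {false} _ ()

≡⇒eqᶠ : ∀ {n} {x y : Fin n} → x ≡ y → Holds (eqᶠ x y)
≡⇒eqᶠ {y = y} refl with y Fin.≟ y
... | yes _   = refl
... | no y≢y = ⊥-elim (y≢y refl)

eqᶠ⇒≡ : ∀ {n} {x y : Fin n} → Holds (eqᶠ x y) → x ≡ y
eqᶠ⇒≡ {x = x} {y} e with x Fin.≟ y
... | yes x≡y = x≡y

allᵇ-elim : ∀ {n} {p : Fin n → Bool} → Holds (allᵇ n p) → ∀ x → Holds (p x)
allᵇ-elim {suc n}     q zero    = ∧-projˡ q
allᵇ-elim {suc n} {p} q (suc x) = allᵇ-elim {n} (∧-projʳ {p zero} q) x

allᵇ-intro : ∀ {n} {p : Fin n → Bool} → (∀ x → Holds (p x)) → Holds (allᵇ n p)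
allᵇ-intro {zero}  f = refl
allᵇ-intro {suc n} f = ∧-intro (f zero) (allᵇ-intro (f ∘ suc))

anyᵇ-elim : ∀ {n} {p : Fin n → Bool} → Holds (anyᵇ n p) → ∃ λ x → Holds (p x)
anyᵇ-elim {suc n} {p} q with p zero in eq
... | true  = zero , eq
... | false = let (x , r) = anyᵇ-elim {n} q in suc x , r

anyᵇ-intro : ∀ {n} {p : Fin n → Bool} x → Holds (p x) → Holds (anyᵇ n p)
anyᵇ-intro {suc n} {p} zero    q rewrite q = refl
anyᵇ-intro {suc n} {p} (suc x) q with p zero
... | true  = refl
... | false = anyᵇ-intro x q

countᵇ-zero : ∀ {n} {p : Fin n → Bool} → (∀ x → p x ≡ false) → countᵇ n p ≡ 0
countᵇ-zero {zero}      f = refl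
countᵇ-zero {suc n} {p} f rewrite f zero = countᵇ-zero (f ∘ suc)

countᵇ-pos : ∀ {n} {p : Fin n → Bool} x → Holds (p x) → countᵇ n p ≢ 0
countᵇ-pos {suc n} {p} zero    t rewrite t = λ ()
countᵇ-pos {suc n} {p} (suc x) t with p zero
... | true  = λ ()
... | false = countᵇ-pos x t

countᵇ≡1-elim : ∀ {n} {p : Fin n → Bool} → countᵇ n p ≡ 1 →
  ∃ λ x → Holds (p x) × (∀ y → Holds (p y) → y ≡ x)
countᵇ≡1-elim {suc n} {p} c with p zero in eq
... | true  = zero , eq , λ { zero _ → refl
                            ; (suc y) t → ⊥-elim (countᵇ-pos {p = p ∘ suc} y t (ℕP.+-cancelˡ-≡ 1 _ _ c)) }
... | false = let (x , t , unique) = countᵇ≡1-elim {n} {p ∘ suc} c in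
  suc x , t , λ { zero t′ → ⊥-elim (false⇒¬Holds eq t′) ; (suc y) t′ → cong suc (unique y t′) }

countᵇ≡1-intro : ∀ {n} {p : Fin n → Bool} x → Holds (p x) → (∀ y → Holds (p y) → y ≡ x) → countᵇ n p ≡ 1
countᵇ≡1-intro {suc n} {p} zero t unique rewrite t = cong suc (countᵇ-zero off)
  where
  off : ∀ y → p (suc y) ≡ false
  off y with p (suc y) in eq
  ... | true  with () ← unique (suc y) eq
  ... | false = refl
countᵇ≡1-intro {suc n} {p} (suc x) t unique with p zero in eq
... | true  with () ← unique zero eq
... | false = countᵇ≡1-intro {n} {p ∘ suc} x t λ y t′ → FP.suc-injective (unique (suc y) t′)

≡ᵇ1⇒≡1 : ∀ {n} → Holds (n ℕ.≡ᵇ 1) → n ≡ 1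
≡ᵇ1⇒≡1 {suc zero} _ = refl

injᵇ-elim : ∀ {a b} {f : Fin a → Fin b} → Holds (injᵇ f) → Injective _≡_ _≡_ f
injᵇ-elim p {x} {y} e = eqᶠ⇒≡ (⇒ᵇ-elim (allᵇ-elim (allᵇ-elim p x) y) (≡⇒eqᶠ e))

injᵇ-intro : ∀ {a b} {f : Fin a → Fin b} → Injective _≡_ _≡_ f → Holds (injᵇ f)
injᵇ-intro {f = f} p =
  allᵇ-intro λ x → allᵇ-intro λ y → ⇒ᵇ-intro {eqᶠ (f x) (f y)} λ q → ≡⇒eqᶠ (p (eqᶠ⇒≡ q))

surjᵇ-elim : ∀ {a b} {f : Fin a → Fin b} → Holds (surjᵇ f) → StrictlySurjective _≡_ f
surjᵇ-elim p y = let (x , q) = anyᵇ-elim (allᵇ-elim p y) in x , eqᶠ⇒≡ q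

surjᵇ-intro : ∀ {a b} {f : Fin a → Fin b} → StrictlySurjective _≡_ f → Holds (surjᵇ f)
surjᵇ-intro p = allᵇ-intro λ y → anyᵇ-intro (proj₁ (p y)) (≡⇒eqᶠ (proj₂ (p y)))

module _ (G H : Hypergraph) (hV : VMap G H) (hE : EMap G H) where

  IsInHom IsOnto IsLocInj IsStrong HasLeafComplement : Set
  IsInHom  = ∀ e v → Holds (mem G e v) → Holds (mem H (hE e) (hV v))
  IsOnto   = ∀ e w → Holds (mem H (hE e) w) → ∃ λ v → Holds (mem G e v) × hV v ≡ w
  IsLocInj = ∀ e v v′ → Holds (mem G e v) → Holds (mem G e v′) → hV v ≡ hV v′ → v ≡ v′
  IsStrong = ∀ e v → Holds (mem H (hE e) (hV v)) → Holds (mem G e v)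
  HasLeafComplement = ∀ w → (∀ v → hV v ≢ w) → countᵇ (nE H) (λ e → mem H e w) ≡ 1

  record IsLoInjInHom : Set where
    field
      inHom  : IsInHom
      locInj : IsLocInj

  record IsLoInjHom : Set where
    field
      inHom  : IsInHom
      onto   : IsOnto
      locInj : IsLocInj

  record IsLeafAddInHom : Set where
    field
      inHom  : IsInHom
      strong : IsStrong
      injV   : Injective _≡_ _≡_ hV
      injE   : Injective _≡_ _≡_ hE
      surjE  : StrictlySurjective _≡_ hE
      leaves : HasLeafComplement

  record IsIsomorphism : Set where
    field
      injV   : Injective _≡_ _≡_ hV
      surjV  : StrictlySurjective _≡_ hV
      injE   : Injective _≡_ _≡_ hE
      surjE  : StrictlySurjective _≡_ hE
      inHom  : IsInHom
      strong : IsStrong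

  isInHom⁻ : Holds (isInHom G H hV hE) → IsInHom
  isInHom⁻ p e v = ⇒ᵇ-elim (allᵇ-elim (allᵇ-elim p e) v)

  isInHom⁺ : IsInHom → Holds (isInHom G H hV hE)
  isInHom⁺ p = allᵇ-intro λ e → allᵇ-intro λ v → ⇒ᵇ-intro (p e v)

  isOnto⁻ : Holds (isOnto G H hV hE) → IsOnto
  isOnto⁻ p e w m = let (v , q) = anyᵇ-elim (⇒ᵇ-elim (allᵇ-elim (allᵇ-elim p e) w) m) in
    v , ∧-projˡ q , eqᶠ⇒≡ (∧-projʳ {mem G e v} q)

  isOnto⁺ : IsOnto → Holds (isOnto G H hV hE)
  isOnto⁺ p = allᵇ-intro λ e → allᵇ-intro λ w → ⇒ᵇ-intro λ m →
    let (v , q , r) = p e w m in anyᵇ-intro v (∧-intro q (≡⇒eqᶠ r))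

  isLocInj⁻ : Holds (isLocInj G H hV hE) → IsLocInj
  isLocInj⁻ p e v v′ m m′ q =
    eqᶠ⇒≡ (⇒ᵇ-elim (allᵇ-elim (allᵇ-elim (allᵇ-elim p e) v) v′) (∧-intro m (∧-intro m′ (≡⇒eqᶠ q))))

  isLocInj⁺ : IsLocInj → Holds (isLocInj G H hV hE)
  isLocInj⁺ p = allᵇ-intro λ e → allᵇ-intro λ v → allᵇ-intro λ v′ → ⇒ᵇ-intro λ q →
    let m′q = ∧-projʳ {mem G e v} q in
    ≡⇒eqᶠ (p e v v′ (∧-projˡ q) (∧-projˡ m′q) (eqᶠ⇒≡ (∧-projʳ {mem G e v′} m′q)))

  isStrong⁻ : Holds (isStrong G H hV hE) → IsStrong
  isStrong⁻ p e v = ⇒ᵇ-elim (allᵇ-elim (allᵇ-elim p e) v)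

  isStrong⁺ : IsStrong → Holds (isStrong G H hV hE)
  isStrong⁺ p = allᵇ-intro λ e → allᵇ-intro λ v → ⇒ᵇ-intro (p e v)

  private
    leafᵇ : Bool
    leafᵇ = allᵇ (nV H) λ w → not (anyᵇ (nV G) λ v → eqᶠ (hV v) w) ⇒ᵇ
                               ℕ._≡ᵇ_ (countᵇ (nE H) λ e → mem H e w) 1

  leafᵇ⁻ : Holds leafᵇ → HasLeafComplement
  leafᵇ⁻ p w ∉img = ≡ᵇ1⇒≡1 (⇒ᵇ-elim (allᵇ-elim p w)
    (not-intro λ q → let (v , r) = anyᵇ-elim q in ∉img v (eqᶠ⇒≡ r)))

  leafᵇ⁺ : HasLeafComplement → Holds leafᵇ
  leafᵇ⁺ p = allᵇ-intro λ w → ⇒ᵇ-intro λ q →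
    cong (ℕ._≡ᵇ 1) (p w λ v r → not-elim q (anyᵇ-intro v (≡⇒eqᶠ r)))

  isLoInjInHom⁻ : Holds (isInHom G H hV hE ∧ isLocInj G H hV hE) → IsLoInjInHom
  isLoInjInHom⁻ p = record
    { inHom = isInHom⁻ (∧-projˡ p) ; locInj = isLocInj⁻ (∧-projʳ {isInHom G H hV hE} p) }

  isLoInjInHom⁺ : IsLoInjInHom → Holds (isInHom G H hV hE ∧ isLocInj G H hV hE)
  isLoInjInHom⁺ p = ∧-intro (isInHom⁺ inHom) (isLocInj⁺ locInj)
    where open IsLoInjInHom p

  isLoInjHom⁻ : Holds (isHom G H hV hE ∧ isLocInj G H hV hE) → IsLoInjHom
  isLoInjHom⁻ p = record
    { inHom  = isInHom⁻ (∧-projˡ (∧-projˡ p))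
    ; onto   = isOnto⁻ (∧-projʳ {isInHom G H hV hE} (∧-projˡ p))
    ; locInj = isLocInj⁻ (∧-projʳ {isHom G H hV hE} p) }

  isLoInjHom⁺ : IsLoInjHom → Holds (isHom G H hV hE ∧ isLocInj G H hV hE)
  isLoInjHom⁺ p = ∧-intro (∧-intro (isInHom⁺ inHom) (isOnto⁺ onto)) (isLocInj⁺ locInj)
    where open IsLoInjHom p

  isLeafAddInHom⁻ : Holds (isInHom G H hV hE ∧ isLeafAdding G H hV hE) → IsLeafAddInHom
  isLeafAddInHom⁻ p = record
    { inHom  = isInHom⁻ (∧-projˡ p)
    ; strong = isStrong⁻ (∧-projˡ q)
    ; injV   = injᵇ-elim (∧-projˡ q₁)
    ; injE   = injᵇ-elim (∧-projˡ q₂)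
    ; surjE  = surjᵇ-elim (∧-projˡ q₃)
    ; leaves = leafᵇ⁻ (∧-projʳ {surjᵇ hE} q₃) }
    where
    q  = ∧-projʳ {isInHom G H hV hE} p
    q₁ = ∧-projʳ {isStrong G H hV hE} q
    q₂ = ∧-projʳ {injᵇ hV} q₁
    q₃ = ∧-projʳ {injᵇ hE} q₂

  isLeafAddInHom⁺ : IsLeafAddInHom → Holds (isInHom G H hV hE ∧ isLeafAdding G H hV hE)
  isLeafAddInHom⁺ p = ∧-intro (isInHom⁺ inHom) (∧-intro (isStrong⁺ strong) (∧-intro (injᵇ-intro injV)
    (∧-intro (injᵇ-intro injE) (∧-intro (surjᵇ-intro surjE) (leafᵇ⁺ leaves)))))
    where open IsLeafAddInHom p

  isIso⁻ : Holds (isIso G H hV hE) → IsIsomorphism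
  isIso⁻ p = record
    { injV   = injᵇ-elim (∧-projˡ p)
    ; surjV  = surjᵇ-elim (∧-projˡ q₁)
    ; injE   = injᵇ-elim (∧-projˡ q₂)
    ; surjE  = surjᵇ-elim (∧-projˡ q₃)
    ; inHom  = λ e v → ⇔ᵇ-to (allᵇ-elim (allᵇ-elim q₄ e) v)
    ; strong = λ e v → ⇔ᵇ-from (allᵇ-elim (allᵇ-elim q₄ e) v) }
    where
    q₁ = ∧-projʳ {injᵇ hV} p
    q₂ = ∧-projʳ {surjᵇ hV} q₁
    q₃ = ∧-projʳ {injᵇ hE} q₂
    q₄ = ∧-projʳ {surjᵇ hE} q₃

  isIso⁺ : IsIsomorphism → Holds (isIso G H hV hE)
  isIso⁺ p = ∧-intro (injᵇ-intro injV) (∧-intro (surjᵇ-intro surjV) (∧-intro (injᵇ-intro injE)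
    (∧-intro (surjᵇ-intro surjE) (allᵇ-intro λ e → allᵇ-intro λ v → ⇔ᵇ-intro (inHom e v) (strong e v)))))
    where open IsIsomorphism p

module _ {G H : Hypergraph} {hV hV′ : VMap G H} {hE hE′ : EMap G H}
         (eV : hV ≗ hV′) (eE : hE ≗ hE′) where
  private
    mem-resp : ∀ {e v} → Holds (mem H (hE e) (hV v)) → Holds (mem H (hE′ e) (hV′ v))
    mem-resp {e} {v} = subst₂ (λ a b → Holds (mem H a b)) (eE e) (eV v)

    mem-resp⁻¹ : ∀ {e v} → Holds (mem H (hE′ e) (hV′ v)) → Holds (mem H (hE e) (hV v))
    mem-resp⁻¹ {e} {v} = subst₂ (λ a b → Holds (mem H a b)) (sym (eE e)) (sym (eV v))

    inj-resp : ∀ {a b} {f f′ : Fin a → Fin b} → f ≗ f′ → Injective _≡_ _≡_ f → Injective _≡_ _≡_ f′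
    inj-resp {f = f} e p {x} {y} q = p (trans (e x) (trans q (sym (e y))))

    surj-resp : ∀ {a b} {f f′ : Fin a → Fin b} → f ≗ f′ → StrictlySurjective _≡_ f → StrictlySurjective _≡_ f′
    surj-resp e p y = proj₁ (p y) , trans (sym (e _)) (proj₂ (p y))

    locInj-resp : IsLocInj G H hV hE → IsLocInj G H hV′ hE′
    locInj-resp p e v v′ m m′ q = p e v v′ m m′ (trans (eV v) (trans q (sym (eV v′))))

  IsLoInjInHom-resp-≗ : IsLoInjInHom G H hV hE → IsLoInjInHom G H hV′ hE′
  IsLoInjInHom-resp-≗ p = record
    { inHom  = λ e v m → mem-resp (IsLoInjInHom.inHom p e v m)
    ; locInj = locInj-resp (IsLoInjInHom.locInj p) }

  IsLoInjHom-resp-≗ : IsLoInjHom G H hV hE → IsLoInjHom G H hV′ hE′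
  IsLoInjHom-resp-≗ p = record
    { inHom  = λ e v m → mem-resp (inHom e v m)
    ; onto   = λ e w m → let (v , mv , hv≡w) = onto e w (subst (λ ε → Holds (mem H ε w)) (sym (eE e)) m)
                         in v , mv , trans (sym (eV v)) hv≡w
    ; locInj = locInj-resp locInj }
    where open IsLoInjHom p

  IsLeafAddInHom-resp-≗ : IsLeafAddInHom G H hV hE → IsLeafAddInHom G H hV′ hE′
  IsLeafAddInHom-resp-≗ p = record
    { inHom  = λ e v m → mem-resp (inHom e v m)
    ; strong = λ e v m → strong e v (mem-resp⁻¹ m)
    ; injV   = inj-resp eV injV
    ; injE   = inj-resp eE injE
    ; surjE  = surj-resp eE surjE
    ; leaves = λ w ∉img → leaves w (λ v q → ∉img v (trans (sym (eV v)) q)) }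
    where open IsLeafAddInHom p

  IsIsomorphism-resp-≗ : IsIsomorphism G H hV hE → IsIsomorphism G H hV′ hE′
  IsIsomorphism-resp-≗ p = record
    { injV   = inj-resp eV injV
    ; surjV  = surj-resp eV surjV
    ; injE   = inj-resp eE injE
    ; surjE  = surj-resp eE surjE
    ; inHom  = λ e v m → mem-resp (inHom e v m)
    ; strong = λ e v m → strong e v (mem-resp⁻¹ m) }
    where open IsIsomorphism p

id-isIsomorphism : (A : Hypergraph) → IsIsomorphism A A id id
id-isIsomorphism A = record
  { injV = id ; surjV = λ y → y , refl ; injE = id ; surjE = λ y → y , refl
  ; inHom = λ _ _ m → m ; strong = λ _ _ m → m }

id-isLeafAddInHom : (A : Hypergraph) → IsLeafAddInHom A A id id
id-isLeafAddInHom A = record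
  { inHom = λ _ _ m → m ; strong = λ _ _ m → m ; injV = id ; injE = id
  ; surjE = λ y → y , refl ; leaves = λ w ∉img → ⊥-elim (∉img w refl) }

⟦_⟧ : Bool → ℕ
⟦ b ⟧ = if b then 1 else 0

⟦∧⟧ : ∀ a b → ⟦ a ∧ b ⟧ ≡ ⟦ a ⟧ * ⟦ b ⟧
⟦∧⟧ true  b = sym (ℕP.+-identityʳ _)
⟦∧⟧ false b = refl

∑-mono-≤ : {X : Set} (xs : List X) {f g : X → ℕ} → (∀ x → f x ≤ g x) → ∑ xs f ≤ ∑ xs g
∑-mono-≤ []       le = z≤n
∑-mono-≤ (x ∷ xs) le = ℕP.+-mono-≤ (le x) (∑-mono-≤ xs le)

∑≢0⇒∃ : {X : Set} (xs : List X) (f : X → ℕ) → ∑ xs f ≢ 0 → ∃ λ x → f x ≢ 0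
∑≢0⇒∃ []       f ne = ⊥-elim (ne refl)
∑≢0⇒∃ (x ∷ xs) f ne with f x ℕ.≟ 0
... | no  fx≢0 = x , fx≢0
... | yes fx≡0 = ∑≢0⇒∃ xs f λ e → ne (trans (cong (_+ ∑ xs f) fx≡0) e)

∑-cartesianProduct : {X Y : Set} (xs : List X) (ys : List Y) (f : X × Y → ℕ) →
  ∑ (cartesianProduct xs ys) f ≡ ∑ xs (λ x → ∑ ys (λ y → f (x , y)))
∑-cartesianProduct []       ys f = refl
∑-cartesianProduct (x ∷ xs) ys f =
  trans (∑-++ (map (x ,_) ys) _ f) (cong₂ _+_ (∑-map ys (x ,_) f) (∑-cartesianProduct xs ys f))

_≗ᵇ_ : ∀ {a b} → (Fin a → Fin b) → (Fin a → Fin b) → Bool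
_≗ᵇ_ {a} f g = allᵇ a λ x → eqᶠ (f x) (g x)

≗ᵇ⇒≗ : ∀ {a b} {f g : Fin a → Fin b} → Holds (f ≗ᵇ g) → f ≗ g
≗ᵇ⇒≗ p x = eqᶠ⇒≡ (allᵇ-elim p x)

≗⇒≗ᵇ : ∀ {a b} {f g : Fin a → Fin b} → f ≗ g → Holds (f ≗ᵇ g)
≗⇒≗ᵇ p = allᵇ-intro λ x → ≡⇒eqᶠ (p x)

∑-allFin-eqᶠ : ∀ n (y : Fin n) → ∑ (allFin n) (λ x → ⟦ eqᶠ x y ⟧) ≡ 1
∑-allFin-eqᶠ n y =
  trans (∑-allFin-δ n _ y (λ x x≢y → cong ⟦_⟧ (eqᶠ-false x≢y))) (cong ⟦_⟧ (≡⇒eqᶠ {x = y} refl))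
  where
  eqᶠ-false : ∀ {x} → x ≢ y → eqᶠ x y ≡ false
  eqᶠ-false {x} x≢y with x Fin.≟ y
  ... | yes x≡y = ⊥-elim (x≢y x≡y)
  ... | no _    = refl

∑-allFuns-≗ᵇ : ∀ a b (f : Fin a → Fin b) → ∑ (allFuns a b) (λ g → ⟦ g ≗ᵇ f ⟧) ≡ 1
∑-allFuns-≗ᵇ zero    b f = refl
∑-allFuns-≗ᵇ (suc a) b f = begin
    ∑ (allFuns (suc a) b) (λ g → ⟦ g ≗ᵇ f ⟧)
  ≡⟨ ∑-concatMap (allFin b) _ _ ⟩
    ∑ (allFin b) (λ x → ∑ (map (x VF.∷_) (allFuns a b)) (λ g → ⟦ g ≗ᵇ f ⟧))
  ≡⟨ ∑-cong (allFin b) (λ x → ∑-map (allFuns a b) (x VF.∷_) _) ⟩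
    ∑ (allFin b) (λ x → ∑ (allFuns a b) (λ g → ⟦ eqᶠ x (f zero) ∧ (g ≗ᵇ (f ∘ suc)) ⟧))
  ≡⟨ ∑-cong (allFin b) (λ x → trans (∑-cong (allFuns a b) (λ g → ⟦∧⟧ (eqᶠ x (f zero)) _))
                                    (∑-*ˡ (allFuns a b) ⟦ eqᶠ x (f zero) ⟧ _)) ⟩
    ∑ (allFin b) (λ x → ⟦ eqᶠ x (f zero) ⟧ * ∑ (allFuns a b) (λ g → ⟦ g ≗ᵇ (f ∘ suc) ⟧))
  ≡⟨ ∑-cong (allFin b) (λ x → trans (cong (⟦ eqᶠ x (f zero) ⟧ *_) (∑-allFuns-≗ᵇ a b (f ∘ suc)))
                                    (ℕP.*-identityʳ _)) ⟩
    ∑ (allFin b) (λ x → ⟦ eqᶠ x (f zero) ⟧)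
  ≡⟨ ∑-allFin-eqᶠ b (f zero) ⟩
    1
  ∎
  where open ≡-Reasoning

-- A finite set listed once per class of a boolean equivalence; maps between hypergraphs are
-- functions, which can only be compared pointwise.
record Enumeration : Set₁ where
  field
    Carrier : Set
    elems   : List Carrier
    _≈ᵇ_    : Carrier → Carrier → Bool
    unique  : ∀ x → ∑ elems (λ y → ⟦ y ≈ᵇ x ⟧) ≡ 1

  countᴱ : (Carrier → Bool) → ℕ
  countᴱ P = ∑ elems (λ x → ⟦ P x ⟧)

  Respects≈ᵇ : (Carrier → Bool) → Set
  Respects≈ᵇ P = ∀ x y → Holds (x ≈ᵇ y) → P x ≡ P y

  countᴱ-pos : (P : Carrier → Bool) → Respects≈ᵇ P → ∀ x₀ → Holds (P x₀) → countᴱ P ≢ 0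
  countᴱ-pos P resp x₀ p count≡0 = ℕP.1+n≢0 (ℕP.n≤0⇒n≡0 (begin
      1                            ≡⟨ sym (unique x₀) ⟩
      ∑ elems (λ x → ⟦ x ≈ᵇ x₀ ⟧)  ≤⟨ ∑-mono-≤ elems ≈ᵇ≤P ⟩
      countᴱ P                     ≡⟨ count≡0 ⟩
      0                            ∎))
    where
    open ℕP.≤-Reasoning
    ≈ᵇ≤P : ∀ x → ⟦ x ≈ᵇ x₀ ⟧ ≤ ⟦ P x ⟧
    ≈ᵇ≤P x with x ≈ᵇ x₀ in q
    ... | false = z≤n
    ... | true rewrite resp x x₀ q | p = ℕP.≤-refl

  countᴱ≢0⇒∃ : (P : Carrier → Bool) → countᴱ P ≢ 0 → ∃ λ x → Holds (P x)
  countᴱ≢0⇒∃ P ne with ∑≢0⇒∃ elems _ ne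
  ... | x , Px≢0 with P x in Px
  ... | true  = x , Px
  ... | false = ⊥-elim (Px≢0 refl)

open Enumeration public using (Carrier; elems; _≈ᵇ_; countᴱ; Respects≈ᵇ; countᴱ-pos; countᴱ≢0⇒∃)

functions : ℕ → ℕ → Enumeration
functions a b = record
  { Carrier = Fin a → Fin b ; elems = allFuns a b ; _≈ᵇ_ = _≗ᵇ_ ; unique = ∑-allFuns-≗ᵇ a b }

_×ᴱ_ : Enumeration → Enumeration → Enumeration
S ×ᴱ T = record
  { Carrier = S.Carrier × T.Carrier
  ; elems   = cartesianProduct S.elems T.elems
  ; _≈ᵇ_    = λ p q → (proj₁ p S.≈ᵇ proj₁ q) ∧ (proj₂ p T.≈ᵇ proj₂ q)
  ; unique  = λ { (x , y) → begin
      ∑ (cartesianProduct S.elems T.elems) (λ q → ⟦ (proj₁ q S.≈ᵇ x) ∧ (proj₂ q T.≈ᵇ y) ⟧)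
    ≡⟨ ∑-cartesianProduct S.elems T.elems _ ⟩
      ∑ S.elems (λ x′ → ∑ T.elems (λ y′ → ⟦ (x′ S.≈ᵇ x) ∧ (y′ T.≈ᵇ y) ⟧))
    ≡⟨ ∑-cong S.elems (λ x′ → trans (∑-cong T.elems (λ y′ → ⟦∧⟧ (x′ S.≈ᵇ x) (y′ T.≈ᵇ y)))
                                    (∑-*ˡ T.elems ⟦ x′ S.≈ᵇ x ⟧ _)) ⟩
      ∑ S.elems (λ x′ → ⟦ x′ S.≈ᵇ x ⟧ * ∑ T.elems (λ y′ → ⟦ y′ T.≈ᵇ y ⟧))
    ≡⟨ ∑-cong S.elems (λ x′ → trans (cong (⟦ x′ S.≈ᵇ x ⟧ *_) (T.unique y)) (ℕP.*-identityʳ _)) ⟩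
      ∑ S.elems (λ x′ → ⟦ x′ S.≈ᵇ x ⟧)
    ≡⟨ S.unique x ⟩
      1
    ∎ } }
  where
  module S = Enumeration S
  module T = Enumeration T
  open ≡-Reasoning

-- Both counts equal the number of pairs in the common graph of Φ on P and of Ψ on Q.
countᴱ-transfer : (S T : Enumeration) (P : Carrier S → Bool) (Q : Carrier T → Bool)
  (Φ : Carrier S → Carrier T) (Ψ : Carrier T → Carrier S) →
  (∀ x y → (P x ∧ (_≈ᵇ_ T y (Φ x))) ≡ (Q y ∧ (_≈ᵇ_ S x (Ψ y)))) →
  countᴱ S P ≡ countᴱ T Q
countᴱ-transfer S T P Q Φ Ψ graph = begin
    ∑ S.elems (λ x → ⟦ P x ⟧)
  ≡⟨ ∑-cong S.elems (λ x → sym (trans (cong (⟦ P x ⟧ *_) (T.unique (Φ x))) (ℕP.*-identityʳ _))) ⟩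
    ∑ S.elems (λ x → ⟦ P x ⟧ * ∑ T.elems (λ y → ⟦ y T.≈ᵇ Φ x ⟧))
  ≡⟨ ∑-cong S.elems (λ x → sym (∑-*ˡ T.elems ⟦ P x ⟧ _)) ⟩
    ∑ S.elems (λ x → ∑ T.elems (λ y → ⟦ P x ⟧ * ⟦ y T.≈ᵇ Φ x ⟧))
  ≡⟨ ∑-cong S.elems (λ x → ∑-cong T.elems (λ y → trans (sym (⟦∧⟧ (P x) _)) (cong ⟦_⟧ (graph x y)))) ⟩
    ∑ S.elems (λ x → ∑ T.elems (λ y → ⟦ Q y ∧ (x S.≈ᵇ Ψ y) ⟧))
  ≡⟨ ∑-swap S.elems T.elems _ ⟩
    ∑ T.elems (λ y → ∑ S.elems (λ x → ⟦ Q y ∧ (x S.≈ᵇ Ψ y) ⟧))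
  ≡⟨ ∑-cong T.elems (λ y → trans (∑-cong S.elems (λ x → ⟦∧⟧ (Q y) _)) (∑-*ˡ S.elems ⟦ Q y ⟧ _)) ⟩
    ∑ T.elems (λ y → ⟦ Q y ⟧ * ∑ S.elems (λ x → ⟦ x S.≈ᵇ Ψ y ⟧))
  ≡⟨ ∑-cong T.elems (λ y → trans (cong (⟦ Q y ⟧ *_) (S.unique (Ψ y))) (ℕP.*-identityʳ _)) ⟩
    ∑ T.elems (λ y → ⟦ Q y ⟧)
  ∎
  where
  module S = Enumeration S
  module T = Enumeration T
  open ≡-Reasoning

Maps : Hypergraph → Hypergraph → Enumeration
Maps X Y = functions (nV X) (nV Y) ×ᴱ functions (nE X) (nE Y)

Map : Hypergraph → Hypergraph → Set
Map X Y = VMap X Y × EMap X Y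

count≡countᴱ : (X Y : Hypergraph) (P : VMap X Y → EMap X Y → Bool) →
  count X Y P ≡ countᴱ (Maps X Y) (λ h → P (proj₁ h) (proj₂ h))
count≡countᴱ X Y P = sym (∑-cartesianProduct (allFuns (nV X) (nV Y)) (allFuns (nE X) (nE Y)) _)

≈ᵇ⇒≗ : {X Y : Hypergraph} {h h′ : Map X Y} → Holds (_≈ᵇ_ (Maps X Y) h h′) →
  proj₁ h ≗ proj₁ h′ × proj₂ h ≗ proj₂ h′
≈ᵇ⇒≗ {h = h} p = ≗ᵇ⇒≗ (∧-projˡ p) , ≗ᵇ⇒≗ (∧-projʳ {proj₁ h ≗ᵇ _} p)

≗⇒≈ᵇ : {X Y : Hypergraph} {h h′ : Map X Y} →
  proj₁ h ≗ proj₁ h′ → proj₂ h ≗ proj₂ h′ → Holds (_≈ᵇ_ (Maps X Y) h h′)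
≗⇒≈ᵇ p q = ∧-intro (≗⇒≗ᵇ p) (≗⇒≗ᵇ q)

leafAddᵇ isoᵇ : (A B : Hypergraph) → Map A B → Bool
leafAddᵇ A B (gV , gE) = isInHom A B gV gE ∧ isLeafAdding A B gV gE
isoᵇ     A B (tV , tE) = isIso A B tV tE

leafAddᵇ-resp : ∀ A B → Respects≈ᵇ (Maps A B) (leafAddᵇ A B)
leafAddᵇ-resp A B g g′ p = Holds-ext
  (λ t → isLeafAddInHom⁺ A B _ _ (IsLeafAddInHom-resp-≗ g≗₁ g≗₂ (isLeafAddInHom⁻ A B _ _ t)))
  (λ t → isLeafAddInHom⁺ A B _ _ (IsLeafAddInHom-resp-≗ (sym ∘ g≗₁) (sym ∘ g≗₂) (isLeafAddInHom⁻ A B _ _ t)))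
  where
  g≗₁ = proj₁ (≈ᵇ⇒≗ {A} {B} {g} p)
  g≗₂ = proj₂ (≈ᵇ⇒≗ {A} {B} {g} p)

isoᵇ-resp : ∀ A B → Respects≈ᵇ (Maps A B) (isoᵇ A B)
isoᵇ-resp A B τ τ′ p = Holds-ext
  (λ t → isIso⁺ A B _ _ (IsIsomorphism-resp-≗ τ≗₁ τ≗₂ (isIso⁻ A B _ _ t)))
  (λ t → isIso⁺ A B _ _ (IsIsomorphism-resp-≗ (sym ∘ τ≗₁) (sym ∘ τ≗₂) (isIso⁻ A B _ _ t)))
  where
  τ≗₁ = proj₁ (≈ᵇ⇒≗ {A} {B} {τ} p)
  τ≗₂ = proj₂ (≈ᵇ⇒≗ {A} {B} {τ} p)

LeafAddInHom≡countᴱ : ∀ A B → LeafAddInHom A B ≡ countᴱ (Maps A B) (leafAddᵇ A B)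
LeafAddInHom≡countᴱ A B = count≡countᴱ A B (λ gV gE → isInHom A B gV gE ∧ isLeafAdding A B gV gE)

choose : ∀ {n} → (Fin n → Bool) → Fin n → Fin n
choose p d with FP.any? (λ x → p x Bool.≟ true)
... | yes (x , _) = x
... | no  _       = d

choose-spec : ∀ {n} (p : Fin n → Bool) d y → Holds (p y) → Holds (p (choose p d))
choose-spec p d y py with FP.any? (λ x → p x Bool.≟ true)
... | yes (_ , px) = px
... | no  ∄x      = ⊥-elim (∄x (y , py))

-- d y is returned when y has no preimage.
invert : ∀ {a b} → (Fin a → Fin b) → (Fin b → Fin a) → Fin b → Fin a
invert f d y = choose (λ x → eqᶠ (f x) y) (d y)

invert-inverseʳ : ∀ {a b} (f : Fin a → Fin b) d → StrictlySurjective _≡_ f → ∀ y → f (invert f d y) ≡ y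
invert-inverseʳ f d surj y =
  eqᶠ⇒≡ (choose-spec (λ x → eqᶠ (f x) y) (d y) (proj₁ (surj y)) (≡⇒eqᶠ (proj₂ (surj y))))

invert-inverseˡ : ∀ {a b} (f : Fin a → Fin b) d → Injective _≡_ _≡_ f → ∀ x → invert f d (f x) ≡ x
invert-inverseˡ f d inj x = inj (eqᶠ⇒≡ (choose-spec (λ z → eqᶠ (f z) (f x)) (d (f x)) x (≡⇒eqᶠ {x = f x} refl)))

section-injective : ∀ {a b} {f : Fin a → Fin b} (surj : StrictlySurjective _≡_ f) →
  Injective _≡_ _≡_ (λ y → proj₁ (surj y))
section-injective {f = f} surj {x} {y} q =
  trans (sym (proj₂ (surj x))) (trans (cong f q) (proj₂ (surj y)))

injective⇒surjective : ∀ {m n} (f : Fin m → Fin n) → Injective _≡_ _≡_ f → n ≤ m → StrictlySurjective _≡_ f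
injective⇒surjective {m} {suc n} f inj n≤m y with FP.any? (λ x → f x FP.≟ y)
... | yes found = found
... | no  ∉img  = ⊥-elim (ℕP.<-irrefl refl (ℕP.<-≤-trans n≤m (FP.injective⇒≤ punched-injective)))
  where
  punched : Fin m → Fin n
  punched x = Fin.punchOut {i = y} {j = f x} (λ r → ∉img (x , sym r))
  punched-injective : Injective _≡_ _≡_ punched
  punched-injective {x} {x′} q =
    inj (FP.punchOut-injective (λ r → ∉img (x , sym r)) (λ r → ∉img (x′ , sym r)) q)

iso-size : ∀ {X Y : Hypergraph} {tV tE} → IsIsomorphism X Y tV tE → size X ≡ size Y
iso-size t = cong₂ _+_ (FP.cantor-schröder-bernstein injV (section-injective surjV))
                       (FP.cantor-schröder-bernstein injE (section-injective surjE))
  where open IsIsomorphism t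

∘-isLoInjInHom : ∀ {G A H} {gV gE kV kE} → IsLeafAddInHom G A gV gE → IsLoInjHom A H kV kE →
  IsLoInjInHom G H (kV ∘ gV) (kE ∘ gE)
∘-isLoInjInHom {gV = gV} {gE} g k = record
  { inHom  = λ e v m → k.inHom (gE e) (gV v) (g.inHom e v m)
  ; locInj = λ e v v′ m m′ q → g.injV (k.locInj (gE e) (gV v) (gV v′) (g.inHom e v m) (g.inHom e v′ m′) q) }
  where
  module g = IsLeafAddInHom g
  module k = IsLoInjHom k

module AlongIsomorphism {G A B H : Hypergraph} {tV : VMap A B} {tE : EMap A B} (t : IsIsomorphism A B tV tE)
                        (dV : Fin (nV B) → Fin (nV A)) (dE : Fin (nE B) → Fin (nE A)) where
  private module t = IsIsomorphism t

  sV : VMap B A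
  sV = invert tV dV

  sE : EMap B A
  sE = invert tE dE

  tsV : ∀ y → tV (sV y) ≡ y
  tsV = invert-inverseʳ tV dV t.surjV

  stV : ∀ x → sV (tV x) ≡ x
  stV = invert-inverseˡ tV dV t.injV

  tsE : ∀ y → tE (sE y) ≡ y
  tsE = invert-inverseʳ tE dE t.surjE

  stE : ∀ x → sE (tE x) ≡ x
  stE = invert-inverseˡ tE dE t.injE

  private
    mem-back : ∀ ε y → Holds (mem B ε y) → Holds (mem A (sE ε) (sV y))
    mem-back ε y m = t.strong (sE ε) (sV y) (subst₂ (λ a b → Holds (mem B a b)) (sym (tsE ε)) (sym (tsV y)) m)

  postcompose : ∀ {gV gE} → IsLeafAddInHom G A gV gE → IsLeafAddInHom G B (tV ∘ gV) (tE ∘ gE)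
  postcompose {gV} {gE} g = record
    { inHom  = λ e v m → t.inHom (gE e) (gV v) (g.inHom e v m)
    ; strong = λ e v m → g.strong e v (t.strong (gE e) (gV v) m)
    ; injV   = g.injV ∘ t.injV
    ; injE   = g.injE ∘ t.injE
    ; surjE  = λ ε → let (e , q) = g.surjE (sE ε) in e , trans (cong tE q) (tsE ε)
    ; leaves = leaves }
    where
    module g = IsLeafAddInHom g
    leaves : HasLeafComplement G B (tV ∘ gV) (tE ∘ gE)
    leaves w ∉img = countᵇ≡1-intro (tE e₀) m₀ unique
      where
      ∉img′ : ∀ v → gV v ≢ sV w
      ∉img′ v q = ∉img v (trans (cong tV q) (tsV w))
      c = countᵇ≡1-elim (g.leaves (sV w) ∉img′)
      e₀ = proj₁ c
      m₀ : Holds (mem B (tE e₀) w)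
      m₀ = subst (λ z → Holds (mem B (tE e₀) z)) (tsV w) (t.inHom e₀ (sV w) (proj₁ (proj₂ c)))
      unique : ∀ ε → Holds (mem B ε w) → ε ≡ tE e₀
      unique ε m = trans (sym (tsE ε)) (cong tE (proj₂ (proj₂ c) (sE ε) (mem-back ε w m)))

  precompose : ∀ {kV kE} → IsLoInjHom A H kV kE → IsLoInjHom B H (kV ∘ sV) (kE ∘ sE)
  precompose {kV} {kE} k = record
    { inHom  = λ ε y m → k.inHom (sE ε) (sV y) (mem-back ε y m)
    ; onto   = λ ε w m → let (x , mx , q) = k.onto (sE ε) w m in
                 tV x , subst (λ z → Holds (mem B z (tV x))) (tsE ε) (t.inHom (sE ε) x mx)
                      , trans (cong kV (stV x)) q
    ; locInj = λ ε y y′ m m′ q → trans (sym (tsV y)) (trans (cong tV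
                 (k.locInj (sE ε) (sV y) (sV y′) (mem-back ε y m) (mem-back ε y′ m′) q)) (tsV y′)) }
    where module k = IsLoInjHom k

isIsomorphism-or-size< : ∀ {A B gV gE} → IsLeafAddInHom A B gV gE → IsIsomorphism A B gV gE ⊎ size A < size B
isIsomorphism-or-size< {A} {B} {gV} {gE} g with nV A ℕ.≟ nV B
... | yes nV≡ = inj₁ record
  { injV = g.injV ; surjV = injective⇒surjective gV g.injV (ℕP.≤-reflexive (sym nV≡))
  ; injE = g.injE ; surjE = g.surjE ; inHom = g.inHom ; strong = g.strong }
  where module g = IsLeafAddInHom g
... | no nV≢ = inj₂ (ℕP.+-mono-<-≤ (ℕP.≤∧≢⇒< (FP.injective⇒≤ g.injV) nV≢)
                                  (ℕP.≤-reflexive (FP.cantor-schröder-bernstein g.injE (section-injective g.surjE))))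
  where module g = IsLeafAddInHom g

-- Comparing two factorisations

leaf-edge : ∀ {G A gV gE} → IsLeafAddInHom G A gV gE → ∀ x → (∀ v → x ≢ gV v) →
  ∃ λ e₀ → Holds (mem A (gE e₀) x) × (∀ e → Holds (mem A (gE e) x) → e ≡ e₀)
leaf-edge {A = A} {gE = gE} g x ∉img = e₀ , m₀ , λ e m → g.injE (trans (unique (gE e) m) (sym gEe₀≡ε₀))
  where
  module g = IsLeafAddInHom g
  c = countᵇ≡1-elim (g.leaves x (λ v q → ∉img v (sym q)))
  ε₀ = proj₁ c
  unique = proj₂ (proj₂ c)
  e₀ = proj₁ (g.surjE ε₀)
  gEe₀≡ε₀ : gE e₀ ≡ ε₀
  gEe₀≡ε₀ = proj₂ (g.surjE ε₀)
  m₀ = subst (λ z → Holds (mem A z x)) (sym gEe₀≡ε₀) (proj₁ (proj₂ c))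

record Factorisation (G H A : Hypergraph) : Set where
  field
    gV : VMap G A
    gE : EMap G A
    kV : VMap A H
    kE : EMap A H
    g  : IsLeafAddInHom G A gV gE
    k  : IsLoInjHom A H kV kE

  compositeV : VMap G H
  compositeV = kV ∘ gV

  compositeE : EMap G H
  compositeE = kE ∘ gE

-- The comparison map between two factorisations of the same map is the graph of this relation.
vertexMatchᵇ : (G H A B : Hypergraph) → VMap G A → EMap G A → VMap A H → VMap G B → EMap G B → VMap B H →
  Fin (nV A) → Fin (nV B) → Bool
vertexMatchᵇ G H A B gV gE kV gV′ gE′ kV′ x y =
  eqᶠ (kV x) (kV′ y) ∧ ((allᵇ (nE G) λ e → mem A (gE e) x ⇔ᵇ mem B (gE′ e) y) ∧
                        (allᵇ (nV G) λ v → eqᶠ x (gV v) ⇔ᵇ eqᶠ y (gV′ v)))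

edgeMatchᵇ : (G A B : Hypergraph) → EMap G A → EMap G B → Fin (nE A) → Fin (nE B) → Bool
edgeMatchᵇ G A B gE gE′ ε ε′ = allᵇ (nE G) λ e → eqᶠ ε (gE e) ⇔ᵇ eqᶠ ε′ (gE′ e)

module Comparison {G H A B : Hypergraph} (F : Factorisation G H A) (F′ : Factorisation G H B)
                  (cV : Factorisation.compositeV F ≗ Factorisation.compositeV F′)
                  (cE : Factorisation.compositeE F ≗ Factorisation.compositeE F′) where
  open Factorisation F hiding (compositeV; compositeE)
  open Factorisation F′ using () renaming (gV to gV′; gE to gE′; kV to kV′; kE to kE′; g to g′; k to k′)
  private
    module g  = IsLeafAddInHom g
    module g′ = IsLeafAddInHom g′
    module k  = IsLoInjHom k
    module k′ = IsLoInjHom k′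

  record MatchV (x : Fin (nV A)) (y : Fin (nV B)) : Set where
    field
      sameImage : kV x ≡ kV′ y
      edges⁺    : ∀ e → Holds (mem A (gE e) x) → Holds (mem B (gE′ e) y)
      edges⁻    : ∀ e → Holds (mem B (gE′ e) y) → Holds (mem A (gE e) x)
      preimage⁺ : ∀ v → x ≡ gV v → y ≡ gV′ v
      preimage⁻ : ∀ v → y ≡ gV′ v → x ≡ gV v

  record MatchE (ε : Fin (nE A)) (ε′ : Fin (nE B)) : Set where
    field
      preimage⁺ : ∀ e → ε ≡ gE e → ε′ ≡ gE′ e
      preimage⁻ : ∀ e → ε′ ≡ gE′ e → ε ≡ gE e

  matchVᵇ : Fin (nV A) → Fin (nV B) → Bool
  matchVᵇ = vertexMatchᵇ G H A B gV gE kV gV′ gE′ kV′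

  matchEᵇ : Fin (nE A) → Fin (nE B) → Bool
  matchEᵇ = edgeMatchᵇ G A B gE gE′

  matchVᵇ⁻ : ∀ {x y} → Holds (matchVᵇ x y) → MatchV x y
  matchVᵇ⁻ {x} {y} p = record
    { sameImage = eqᶠ⇒≡ (∧-projˡ p)
    ; edges⁺    = λ e → ⇔ᵇ-to (allᵇ-elim q₁ e)
    ; edges⁻    = λ e → ⇔ᵇ-from (allᵇ-elim q₁ e)
    ; preimage⁺ = λ v r → eqᶠ⇒≡ (⇔ᵇ-to (allᵇ-elim q₂ v) (≡⇒eqᶠ r))
    ; preimage⁻ = λ v r → eqᶠ⇒≡ (⇔ᵇ-from (allᵇ-elim q₂ v) (≡⇒eqᶠ r)) }
    where
    q  = ∧-projʳ {eqᶠ (kV x) (kV′ y)} p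
    q₁ = ∧-projˡ q
    q₂ = ∧-projʳ {allᵇ (nE G) λ e → mem A (gE e) x ⇔ᵇ mem B (gE′ e) y} q

  matchVᵇ⁺ : ∀ {x y} → MatchV x y → Holds (matchVᵇ x y)
  matchVᵇ⁺ r = ∧-intro (≡⇒eqᶠ sameImage) (∧-intro (allᵇ-intro λ e → ⇔ᵇ-intro (edges⁺ e) (edges⁻ e))
    (allᵇ-intro λ v → ⇔ᵇ-intro (≡⇒eqᶠ ∘ preimage⁺ v ∘ eqᶠ⇒≡) (≡⇒eqᶠ ∘ preimage⁻ v ∘ eqᶠ⇒≡)))
    where open MatchV r

  matchEᵇ⁻ : ∀ {ε ε′} → Holds (matchEᵇ ε ε′) → MatchE ε ε′
  matchEᵇ⁻ p = record
    { preimage⁺ = λ e q → eqᶠ⇒≡ (⇔ᵇ-to (allᵇ-elim p e) (≡⇒eqᶠ q))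
    ; preimage⁻ = λ e q → eqᶠ⇒≡ (⇔ᵇ-from (allᵇ-elim p e) (≡⇒eqᶠ q)) }

  matchEᵇ⁺ : ∀ {ε ε′} → MatchE ε ε′ → Holds (matchEᵇ ε ε′)
  matchEᵇ⁺ r = allᵇ-intro λ e → ⇔ᵇ-intro (≡⇒eqᶠ ∘ preimage⁺ e ∘ eqᶠ⇒≡) (≡⇒eqᶠ ∘ preimage⁻ e ∘ eqᶠ⇒≡)
    where open MatchE r

  -- A vertex outside the image of g lies in a unique edge g e₀; its match is the
  -- vertex of g′ e₀ over the same vertex of H, which exists since k′ is onto.
  matchV-exists : ∀ x → ∃ (MatchV x)
  matchV-exists x with FP.any? (λ v → x FP.≟ gV v)
  ... | yes (v , refl) = gV′ v , record
    { sameImage = cV v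
    ; edges⁺    = λ e m → g′.inHom e v (g.strong e v m)
    ; edges⁻    = λ e m → g.inHom e v (g′.strong e v m)
    ; preimage⁺ = λ v′ q → cong gV′ (g.injV q)
    ; preimage⁻ = λ v′ q → cong gV (g′.injV q) }
  ... | no ∉img = y , record
    { sameImage = sym ky
    ; edges⁺    = λ e m → subst (λ z → Holds (mem B (gE′ z) y)) (sym (unique e m)) my
    ; edges⁻    = λ e m → subst (λ z → Holds (mem A (gE z) x)) (sym (trans (unique′ e m) (sym (unique′ e₀ my)))) m₀
    ; preimage⁺ = λ v q → ⊥-elim (∉img (v , q))
    ; preimage⁻ = λ v q → ⊥-elim (y∉img v q) }
    where
    x∉img : ∀ v → x ≢ gV v
    x∉img v q = ∉img (v , q)
    le = leaf-edge g x x∉img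
    e₀ = proj₁ le
    m₀ = proj₁ (proj₂ le)
    unique = proj₂ (proj₂ le)
    kx : Holds (mem H (kE′ (gE′ e₀)) (kV x))
    kx = subst (λ z → Holds (mem H z (kV x))) (cE e₀) (k.inHom (gE e₀) x m₀)
    on = k′.onto (gE′ e₀) (kV x) kx
    y = proj₁ on
    my = proj₁ (proj₂ on)
    ky = proj₂ (proj₂ on)
    y∉img : ∀ v → y ≢ gV′ v
    y∉img v q = x∉img v (k.locInj (gE e₀) x (gV v) m₀ (g.inHom e₀ v mv)
                          (trans (sym ky) (trans (cong kV′ q) (sym (cV v)))))
      where
      mv : Holds (mem G e₀ v)
      mv = g′.strong e₀ v (subst (λ z → Holds (mem B (gE′ e₀) z)) q my)
    unique′ = proj₂ (proj₂ (leaf-edge g′ y y∉img))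

  matchV-unique : ∀ {x y y′} → MatchV x y → MatchV x y′ → y ≡ y′
  matchV-unique {x} {y} {y′} r r′ with FP.any? (λ v → x FP.≟ gV v)
  ... | yes (v , q) = trans (MatchV.preimage⁺ r v q) (sym (MatchV.preimage⁺ r′ v q))
  ... | no ∉img = k′.locInj (gE′ e₀) y y′ (MatchV.edges⁺ r e₀ m₀) (MatchV.edges⁺ r′ e₀ m₀)
                    (trans (sym (MatchV.sameImage r)) (MatchV.sameImage r′))
    where
    le = leaf-edge g x (λ v q → ∉img (v , q))
    e₀ = proj₁ le
    m₀ = proj₁ (proj₂ le)

  matchE-exists : ∀ ε → ∃ (MatchE ε)
  matchE-exists ε = gE′ e₀ , record
    { preimage⁺ = λ e q → cong gE′ (g.injE (trans gEe₀≡ε q))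
    ; preimage⁻ = λ e q → trans (sym gEe₀≡ε) (cong gE (g′.injE q)) }
    where
    e₀ = proj₁ (g.surjE ε)
    gEe₀≡ε = proj₂ (g.surjE ε)

  matchE-unique : ∀ {ε ε′ ε″} → MatchE ε ε′ → MatchE ε ε″ → ε′ ≡ ε″
  matchE-unique {ε} r r′ =
    trans (MatchE.preimage⁺ r e₀ (sym gEe₀≡ε)) (sym (MatchE.preimage⁺ r′ e₀ (sym gEe₀≡ε)))
    where
    e₀ = proj₁ (g.surjE ε)
    gEe₀≡ε = proj₂ (g.surjE ε)

  module _ (dV : Fin (nV A) → Fin (nV B)) (dE : Fin (nE A) → Fin (nE B)) where

    σV : VMap A B
    σV x = choose (matchVᵇ x) (dV x)

    σE : EMap A B
    σE ε = choose (matchEᵇ ε) (dE ε)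

    σV-match : ∀ x → MatchV x (σV x)
    σV-match x = let (y , r) = matchV-exists x in
      matchVᵇ⁻ (choose-spec (matchVᵇ x) (dV x) y (matchVᵇ⁺ r))

    σE-match : ∀ ε → MatchE ε (σE ε)
    σE-match ε = let (ε′ , r) = matchE-exists ε in
      matchEᵇ⁻ (choose-spec (matchEᵇ ε) (dE ε) ε′ (matchEᵇ⁺ r))

    σV-unique : ∀ {x y} → MatchV x y → σV x ≡ y
    σV-unique = matchV-unique (σV-match _)

    σE-unique : ∀ {ε ε′} → MatchE ε ε′ → σE ε ≡ ε′
    σE-unique = matchE-unique (σE-match _)

    σV∘gV : ∀ v → σV (gV v) ≡ gV′ v
    σV∘gV v = MatchV.preimage⁺ (σV-match (gV v)) v refl

    σE∘gE : ∀ e → σE (gE e) ≡ gE′ e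
    σE∘gE e = MatchE.preimage⁺ (σE-match (gE e)) e refl

    kV′∘σV : ∀ x → kV′ (σV x) ≡ kV x
    kV′∘σV x = sym (MatchV.sameImage (σV-match x))

    private
      σE-onImage : ∀ ε → let e₀ = proj₁ (g.surjE ε) in ε ≡ gE e₀ × σE ε ≡ gE′ e₀
      σE-onImage ε = let (e₀ , gEe₀≡ε) = g.surjE ε in sym gEe₀≡ε , trans (cong σE (sym gEe₀≡ε)) (σE∘gE e₀)

    kE′∘σE : ∀ ε → kE′ (σE ε) ≡ kE ε
    kE′∘σE ε = let (ε≡ , σε≡) = σE-onImage ε in
      trans (cong kE′ σε≡) (trans (sym (cE _)) (cong kE (sym ε≡)))

    σ-inHom : IsInHom A B σV σE
    σ-inHom ε x m = let (ε≡ , σε≡) = σE-onImage ε in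
      subst (λ z → Holds (mem B z (σV x))) (sym σε≡)
            (MatchV.edges⁺ (σV-match x) _ (subst (λ z → Holds (mem A z x)) ε≡ m))

    σ-strong : IsStrong A B σV σE
    σ-strong ε x m = let (ε≡ , σε≡) = σE-onImage ε in
      subst (λ z → Holds (mem A z x)) (sym ε≡)
            (MatchV.edges⁻ (σV-match x) _ (subst (λ z → Holds (mem B z (σV x))) σε≡ m))

module ComparisonIso {G H A B : Hypergraph} (F : Factorisation G H A) (F′ : Factorisation G H B)
  (cV : Factorisation.compositeV F ≗ Factorisation.compositeV F′)
  (cE : Factorisation.compositeE F ≗ Factorisation.compositeE F′)
  (dV : Fin (nV A) → Fin (nV B)) (dE : Fin (nE A) → Fin (nE B))
  (dV′ : Fin (nV B) → Fin (nV A)) (dE′ : Fin (nE B) → Fin (nE A)) where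
  private
    module C  = Comparison F F′ cV cE
    module C′ = Comparison F′ F (sym ∘ cV) (sym ∘ cE)

    flipV : ∀ {x y} → C.MatchV x y → C′.MatchV y x
    flipV r = record { sameImage = sym sameImage ; edges⁺ = edges⁻ ; edges⁻ = edges⁺
                     ; preimage⁺ = preimage⁻ ; preimage⁻ = preimage⁺ }
      where open C.MatchV r

    flipV′ : ∀ {x y} → C′.MatchV y x → C.MatchV x y
    flipV′ r = record { sameImage = sym sameImage ; edges⁺ = edges⁻ ; edges⁻ = edges⁺
                      ; preimage⁺ = preimage⁻ ; preimage⁻ = preimage⁺ }
      where open C′.MatchV r

    flipE : ∀ {x y} → C.MatchE x y → C′.MatchE y x
    flipE r = record { preimage⁺ = C.MatchE.preimage⁻ r ; preimage⁻ = C.MatchE.preimage⁺ r }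

    flipE′ : ∀ {x y} → C′.MatchE y x → C.MatchE x y
    flipE′ r = record { preimage⁺ = C′.MatchE.preimage⁻ r ; preimage⁻ = C′.MatchE.preimage⁺ r }

  σV = C.σV dV dE
  σE = C.σE dV dE

  private
    σV′ = C′.σV dV′ dE′
    σE′ = C′.σE dV′ dE′

    σV′∘σV : ∀ x → σV′ (σV x) ≡ x
    σV′∘σV x = C′.σV-unique dV′ dE′ (flipV (C.σV-match dV dE x))

    σV∘σV′ : ∀ y → σV (σV′ y) ≡ y
    σV∘σV′ y = C.σV-unique dV dE (flipV′ (C′.σV-match dV′ dE′ y))

    σE′∘σE : ∀ x → σE′ (σE x) ≡ x
    σE′∘σE x = C′.σE-unique dV′ dE′ (flipE (C.σE-match dV dE x))

    σE∘σE′ : ∀ y → σE (σE′ y) ≡ y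
    σE∘σE′ y = C.σE-unique dV dE (flipE′ (C′.σE-match dV′ dE′ y))

  σ-isIsomorphism : IsIsomorphism A B σV σE
  σ-isIsomorphism = record
    { injV   = λ {x} {y} q → trans (sym (σV′∘σV x)) (trans (cong σV′ q) (σV′∘σV y))
    ; surjV  = λ y → σV′ y , σV∘σV′ y
    ; injE   = λ {x} {y} q → trans (sym (σE′∘σE x)) (trans (cong σE′ q) (σE′∘σE y))
    ; surjE  = λ y → σE′ y , σE∘σE′ y
    ; inHom  = C.σ-inHom dV dE
    ; strong = C.σ-strong dV dE }

-- Fibres of composition

module Fibre (G H A : Hypergraph) where

  Composable : Enumeration
  Composable = Maps G A ×ᴱ Maps A H

  loInjHomᵇ : Map A H → Bool
  loInjHomᵇ (kV , kE) = isHom A H kV kE ∧ isLocInj A H kV kE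

  compose : Carrier Composable → Map G H
  compose ((gV , gE) , (kV , kE)) = kV ∘ gV , kE ∘ gE

  inFibreᵇ : Map G H → Carrier Composable → Bool
  inFibreᵇ h q = (leafAddᵇ G A (proj₁ q) ∧ loInjHomᵇ (proj₂ q)) ∧ _≈ᵇ_ (Maps G H) h (compose q)

  fibre : Map G H → ℕ
  fibre h = countᴱ Composable (inFibreᵇ h)

  LeafAddInHom*LoInjHom≡∑fibre : LeafAddInHom G A * LoInjHom A H ≡ ∑ (elems (Maps G H)) fibre
  LeafAddInHom*LoInjHom≡∑fibre = begin
      LeafAddInHom G A * LoInjHom A H
    ≡⟨ cong₂ _*_ (count≡countᴱ G A _) (count≡countᴱ A H _) ⟩
      ∑ Gs (λ g → ⟦ leafAddᵇ G A g ⟧) * ∑ Hs (λ k → ⟦ loInjHomᵇ k ⟧)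
    ≡⟨ sym (∑-*ʳ Gs _ _) ⟩
      ∑ Gs (λ g → ⟦ leafAddᵇ G A g ⟧ * ∑ Hs (λ k → ⟦ loInjHomᵇ k ⟧))
    ≡⟨ ∑-cong Gs (λ g → trans (sym (∑-*ˡ Hs ⟦ leafAddᵇ G A g ⟧ _)) (∑-cong Hs λ k → sym (⟦∧⟧ (leafAddᵇ G A g) _))) ⟩
      ∑ Gs (λ g → ∑ Hs (λ k → ⟦ leafAddᵇ G A g ∧ loInjHomᵇ k ⟧))
    ≡⟨ sym (∑-cartesianProduct Gs Hs (λ q → ⟦ leafAddᵇ G A (proj₁ q) ∧ loInjHomᵇ (proj₂ q) ⟧)) ⟩
      ∑ Qs (λ q → ⟦ P q ⟧)
    ≡⟨ ∑-cong Qs (λ q → sym (trans (cong (⟦ P q ⟧ *_) (Enumeration.unique (Maps G H) (compose q)))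
                                   (ℕP.*-identityʳ _))) ⟩
      ∑ Qs (λ q → ⟦ P q ⟧ * ∑ GHs (λ h → ⟦ _≈ᵇ_ (Maps G H) h (compose q) ⟧))
    ≡⟨ ∑-cong Qs (λ q → trans (sym (∑-*ˡ GHs ⟦ P q ⟧ _)) (∑-cong GHs (λ h → sym (⟦∧⟧ (P q) _)))) ⟩
      ∑ Qs (λ q → ∑ GHs (λ h → ⟦ inFibreᵇ h q ⟧))
    ≡⟨ ∑-swap Qs GHs _ ⟩
      ∑ GHs fibre
    ∎
    where
    open ≡-Reasoning
    Gs = elems (Maps G A)
    Hs = elems (Maps A H)
    GHs = elems (Maps G H)
    Qs = elems Composable
    P : Carrier Composable → Bool
    P q = leafAddᵇ G A (proj₁ q) ∧ loInjHomᵇ (proj₂ q)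

  module _ (q : Carrier Composable) where
    qgV : VMap G A
    qgV = proj₁ (proj₁ q)
    qgE : EMap G A
    qgE = proj₂ (proj₁ q)
    qkV : VMap A H
    qkV = proj₁ (proj₂ q)
    qkE : EMap A H
    qkE = proj₂ (proj₂ q)

  record InFibre (h : Map G H) (q : Carrier Composable) : Set where
    field
      leafAdd  : IsLeafAddInHom G A (qgV q) (qgE q)
      loInjHom : IsLoInjHom A H (qkV q) (qkE q)
      factorV  : ∀ v → proj₁ h v ≡ qkV q (qgV q v)
      factorE  : ∀ e → proj₂ h e ≡ qkE q (qgE q e)

  inFibreᵇ⁻ : ∀ h q → Holds (inFibreᵇ h q) → InFibre h q
  inFibreᵇ⁻ h q p = record
    { leafAdd  = isLeafAddInHom⁻ G A (qgV q) (qgE q) (∧-projˡ (∧-projˡ p))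
    ; loInjHom = isLoInjHom⁻ A H (qkV q) (qkE q) (∧-projʳ {leafAddᵇ G A (proj₁ q)} (∧-projˡ p))
    ; factorV  = proj₁ factor
    ; factorE  = proj₂ factor }
    where factor = ≈ᵇ⇒≗ {G} {H} {h} (∧-projʳ {leafAddᵇ G A (proj₁ q) ∧ loInjHomᵇ (proj₂ q)} p)

  inFibreᵇ⁺ : ∀ h q → InFibre h q → Holds (inFibreᵇ h q)
  inFibreᵇ⁺ h q w = ∧-intro (∧-intro (isLeafAddInHom⁺ G A (qgV q) (qgE q) leafAdd)
                                     (isLoInjHom⁺ A H (qkV q) (qkE q) loInjHom))
                            (≗⇒≈ᵇ {G} {H} {h} factorV factorE)
    where open InFibre w

  toFactorisation : ∀ {h q} → InFibre h q → Factorisation G H A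
  toFactorisation {h} {q} w = record
    { gV = qgV q ; gE = qgE q ; kV = qkV q ; kE = qkE q ; g = InFibre.leafAdd w ; k = InFibre.loInjHom w }

  InFibre-resp-≗ : ∀ {h} q q′ → qgV q ≗ qgV q′ → qgE q ≗ qgE q′ → qkV q ≗ qkV q′ → qkE q ≗ qkE q′ →
    InFibre h q → InFibre h q′
  InFibre-resp-≗ q q′ e₁ e₂ e₃ e₄ w = record
    { leafAdd  = IsLeafAddInHom-resp-≗ e₁ e₂ leafAdd
    ; loInjHom = IsLoInjHom-resp-≗ e₃ e₄ loInjHom
    ; factorV  = λ v → trans (factorV v) (trans (e₃ _) (cong (qkV q′) (e₁ v)))
    ; factorE  = λ e → trans (factorE e) (trans (e₄ _) (cong (qkE q′) (e₂ e))) }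
    where open InFibre w

  inFibreᵇ-resp : ∀ h → Respects≈ᵇ Composable (inFibreᵇ h)
  inFibreᵇ-resp h q q′ p = Holds-ext
    (λ t → inFibreᵇ⁺ h q′ (InFibre-resp-≗ q q′ e₁ e₂ e₃ e₄ (inFibreᵇ⁻ h q t)))
    (λ t → inFibreᵇ⁺ h q (InFibre-resp-≗ q′ q (sym ∘ e₁) (sym ∘ e₂) (sym ∘ e₃) (sym ∘ e₄) (inFibreᵇ⁻ h q′ t)))
    where
    eg = ≈ᵇ⇒≗ {G} {A} {proj₁ q} (∧-projˡ p)
    ek = ≈ᵇ⇒≗ {A} {H} {proj₂ q} (∧-projʳ {_≈ᵇ_ (Maps G A) (proj₁ q) (proj₁ q′)} p)
    e₁ = proj₁ eg
    e₂ = proj₂ eg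
    e₃ = proj₁ ek
    e₄ = proj₂ ek

  fibre≢0⇒∃ : ∀ h → fibre h ≢ 0 → ∃ (InFibre h)
  fibre≢0⇒∃ h ne = let (q , p) = countᴱ≢0⇒∃ Composable (inFibreᵇ h) ne in q , inFibreᵇ⁻ h q p

  fibre≢0⇒isLoInjInHom : ∀ h → fibre h ≢ 0 → IsLoInjInHom G H (proj₁ h) (proj₂ h)
  fibre≢0⇒isLoInjInHom h ne = IsLoInjInHom-resp-≗ (sym ∘ factorV) (sym ∘ factorE) (∘-isLoInjInHom leafAdd loInjHom)
    where open InFibre (proj₂ (fibre≢0⇒∃ h ne))

  -- Once one factorisation (g₀ , k₀) of h is fixed, every other one is (τ ∘ g₀ , k₀ ∘ τ⁻¹)
  -- for a unique automorphism τ of A, namely the comparison map.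
  module FibreSize (h : Map G H) (q₀ : Carrier Composable) (w₀ : InFibre h q₀) where
    private
      g₀V = qgV q₀
      g₀E = qgE q₀
      k₀V = qkV q₀
      k₀E = qkE q₀
      module w₀ = InFibre w₀

    Φ : Carrier Composable → Map A A
    Φ q = (λ x → choose (vertexMatchᵇ G H A A g₀V g₀E k₀V (qgV q) (qgE q) (qkV q) x) x)
        , (λ ε → choose (edgeMatchᵇ G A A g₀E (qgE q) ε) ε)

    Ψ : Map A A → Carrier Composable
    Ψ (τV , τE) = (τV ∘ g₀V , τE ∘ g₀E) , (k₀V ∘ invert τV id , k₀E ∘ invert τE id)

    private
      module C (q : Carrier Composable) (w : InFibre h q) =
        Comparison (toFactorisation w₀) (toFactorisation w)
                   (λ v → trans (sym (w₀.factorV v)) (InFibre.factorV w v))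
                   (λ e → trans (sym (w₀.factorE e)) (InFibre.factorE w e))

      module CI (q : Carrier Composable) (w : InFibre h q) =
        ComparisonIso (toFactorisation w₀) (toFactorisation w)
                      (λ v → trans (sym (w₀.factorV v)) (InFibre.factorV w v))
                      (λ e → trans (sym (w₀.factorE e)) (InFibre.factorE w e)) id id id id

    fibre→aut : ∀ q τ → Holds (inFibreᵇ h q ∧ _≈ᵇ_ (Maps A A) τ (Φ q)) →
                        Holds (isoᵇ A A τ ∧ _≈ᵇ_ Composable q (Ψ τ))
    fibre→aut q (τV , τE) p = ∧-intro (isIso⁺ A A τV τE τ-iso)
      (∧-intro (≗⇒≈ᵇ {G} {A} {proj₁ q} e₁ e₂) (≗⇒≈ᵇ {A} {H} {proj₂ q} e₃ e₄))
      where
      w = inFibreᵇ⁻ h q (∧-projˡ p)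
      τ≗Φ = ≈ᵇ⇒≗ {A} {A} {τV , τE} (∧-projʳ {inFibreᵇ h q} p)
      module Cq = C q w
      τ-iso : IsIsomorphism A A τV τE
      τ-iso = IsIsomorphism-resp-≗ (sym ∘ proj₁ τ≗Φ) (sym ∘ proj₂ τ≗Φ) (CI.σ-isIsomorphism q w)
      e₁ : ∀ v → qgV q v ≡ τV (g₀V v)
      e₁ v = trans (sym (Cq.σV∘gV id id v)) (sym (proj₁ τ≗Φ (g₀V v)))
      e₂ : ∀ e → qgE q e ≡ τE (g₀E e)
      e₂ e = trans (sym (Cq.σE∘gE id id e)) (sym (proj₂ τ≗Φ (g₀E e)))
      e₃ : ∀ y → qkV q y ≡ k₀V (invert τV id y)
      e₃ y = trans (cong (qkV q) (sym (invert-inverseʳ τV id (IsIsomorphism.surjV τ-iso) y)))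
                   (trans (cong (qkV q) (proj₁ τ≗Φ _)) (Cq.kV′∘σV id id _))
      e₄ : ∀ y → qkE q y ≡ k₀E (invert τE id y)
      e₄ y = trans (cong (qkE q) (sym (invert-inverseʳ τE id (IsIsomorphism.surjE τ-iso) y)))
                   (trans (cong (qkE q) (proj₂ τ≗Φ _)) (Cq.kE′∘σE id id _))

    aut→fibre : ∀ q τ → Holds (isoᵇ A A τ ∧ _≈ᵇ_ Composable q (Ψ τ)) →
                        Holds (inFibreᵇ h q ∧ _≈ᵇ_ (Maps A A) τ (Φ q))
    aut→fibre q (τV , τE) p = ∧-intro (inFibreᵇ⁺ h q w) (≗⇒≈ᵇ {A} {A} {τV , τE} τV≗ τE≗)
      where
      τ-iso = isIso⁻ A A τV τE (∧-projˡ p)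
      module τ = IsIsomorphism τ-iso
      pq = ∧-projʳ {isoᵇ A A (τV , τE)} p
      eg = ≈ᵇ⇒≗ {G} {A} {proj₁ q} (∧-projˡ pq)
      ek = ≈ᵇ⇒≗ {A} {H} {proj₂ q} (∧-projʳ {_≈ᵇ_ (Maps G A) (proj₁ q) (proj₁ (Ψ (τV , τE)))} pq)
      e₁ = proj₁ eg
      e₂ = proj₂ eg
      e₃ = proj₁ ek
      e₄ = proj₂ ek
      module T = AlongIsomorphism {G} {A} {A} {H} τ-iso id id
      w : InFibre h q
      w = record
        { leafAdd  = IsLeafAddInHom-resp-≗ (sym ∘ e₁) (sym ∘ e₂) (T.postcompose w₀.leafAdd)
        ; loInjHom = IsLoInjHom-resp-≗ (sym ∘ e₃) (sym ∘ e₄) (T.precompose w₀.loInjHom)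
        ; factorV  = λ v → trans (w₀.factorV v) (trans (cong k₀V (sym (T.stV (g₀V v))))
                                   (trans (cong (k₀V ∘ T.sV) (sym (e₁ v))) (sym (e₃ (qgV q v)))))
        ; factorE  = λ e → trans (w₀.factorE e) (trans (cong k₀E (sym (T.stE (g₀E e))))
                                   (trans (cong (k₀E ∘ T.sE) (sym (e₂ e))) (sym (e₄ (qgE q e))))) }
      module Cq = C q w
      τV-match : ∀ x → Cq.MatchV x (τV x)
      τV-match x = record
        { sameImage = sym (trans (e₃ (τV x)) (cong k₀V (T.stV x)))
        ; edges⁺    = λ e m → subst (λ z → Holds (mem A z (τV x))) (sym (e₂ e)) (τ.inHom (g₀E e) x m)
        ; edges⁻    = λ e m → τ.strong (g₀E e) x (subst (λ z → Holds (mem A z (τV x))) (e₂ e) m)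
        ; preimage⁺ = λ v r → trans (cong τV r) (sym (e₁ v))
        ; preimage⁻ = λ v r → τ.injV (trans r (e₁ v)) }
      τE-match : ∀ ε → Cq.MatchE ε (τE ε)
      τE-match ε = record
        { preimage⁺ = λ e r → trans (cong τE r) (sym (e₂ e))
        ; preimage⁻ = λ e r → τ.injE (trans r (e₂ e)) }
      τV≗ : ∀ x → τV x ≡ proj₁ (Φ q) x
      τV≗ x = sym (Cq.σV-unique id id (τV-match x))
      τE≗ : ∀ ε → τE ε ≡ proj₂ (Φ q) ε
      τE≗ ε = sym (Cq.σE-unique id id (τE-match ε))

    fibre≡Aut : fibre h ≡ Aut A
    fibre≡Aut = trans (countᴱ-transfer Composable (Maps A A) (inFibreᵇ h) (isoᵇ A A) Φ Ψ
                         (λ q τ → Holds-ext (fibre→aut q τ) (aut→fibre q τ)))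
                      (sym (count≡countᴱ A A (isIso A A)))

  fibre≢0⇒≡Aut : ∀ h → fibre h ≢ 0 → fibre h ≡ Aut A
  fibre≢0⇒≡Aut h ne = let (q , w) = fibre≢0⇒∃ h ne in FibreSize.fibre≡Aut h q w

-- The leaf extension

record FinSubset (n : ℕ) (p : Fin n → Bool) : Set where
  field
    card            : ℕ
    card≤n          : card ≤ n
    embed           : Fin card → Fin n
    embed-sat       : ∀ i → Holds (p (embed i))
    embed-injective : Injective _≡_ _≡_ embed
    embed-onto      : ∀ x → Holds (p x) → ∃ λ i → embed i ≡ x

enumerate : ∀ n (p : Fin n → Bool) → FinSubset n p
enumerate zero    p = record
  { card = 0 ; card≤n = z≤n ; embed = λ () ; embed-sat = λ () ; embed-injective = λ {} ; embed-onto = λ () }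
enumerate (suc n) p with p zero in p0 | enumerate n (p ∘ suc)
... | true  | E = record
  { card            = suc card
  ; card≤n          = s≤s card≤n
  ; embed           = embed′
  ; embed-sat       = λ { zero → p0 ; (suc i) → embed-sat i }
  ; embed-injective = λ { {zero} {zero} _ → refl
                        ; {suc i} {suc j} q → cong suc (embed-injective (FP.suc-injective q)) }
  ; embed-onto      = λ { zero _ → zero , refl
                        ; (suc x) t → let (i , q) = embed-onto x t in suc i , cong suc q } }
  where
  open FinSubset E
  embed′ : Fin (suc card) → Fin (suc n)
  embed′ zero    = zero
  embed′ (suc i) = suc (embed i)
... | false | E = record
  { card            = card
  ; card≤n          = ℕP.m≤n⇒m≤1+n card≤n
  ; embed           = suc ∘ embed
  ; embed-sat       = embed-sat
  ; embed-injective = embed-injective ∘ FP.suc-injective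
  ; embed-onto      = λ { zero t → ⊥-elim (false⇒¬Holds p0 t)
                        ; (suc x) t → let (i , q) = embed-onto x t in i , cong suc q } }
  where open FinSubset E

-- The new leaves of G′ are the pairs (e , w) with w ∈ f_H(h_E e) ∖ h_V(f_G e), attached to e;
-- pairs are encoded in Fin (nE G * nV H).
module LeafExtension (G H : Hypergraph) (hV : VMap G H) (hE : EMap G H) (h : IsLoInjInHom G H hV hE) where
  private
    module h = IsLoInjInHom h

    pairs = nE G * nV H

    pair : Fin pairs → Fin (nE G) × Fin (nV H)
    pair = Fin.remQuot (nV H)

    missingᵇ : Fin (nE G) × Fin (nV H) → Bool
    missingᵇ (e , w) = mem H (hE e) w ∧ not (anyᵇ (nV G) λ v → mem G e v ∧ eqᶠ (hV v) w)

    module M = FinSubset (enumerate pairs (missingᵇ ∘ pair))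

    newEdge : Fin M.card → Fin (nE G)
    newEdge i = proj₁ (pair (M.embed i))

    newImage : Fin M.card → Fin (nV H)
    newImage i = proj₂ (pair (M.embed i))

    memᶠ : Fin (nE G) → Fin (nV G + M.card) → Bool
    memᶠ e x = [ mem G e , (λ i → eqᶠ (newEdge i) e) ]′ (splitAt (nV G) x)

    memᶠ-nonempty : ∀ e → Nonempty (Vec.tabulate (memᶠ e))
    memᶠ-nonempty e = v ↑ˡ M.card , VP.lookup⇒[]= (v ↑ˡ M.card) _
      (trans (VP.lookup∘tabulate (memᶠ e) (v ↑ˡ M.card))
             (trans (cong [ mem G e , _ ]′ (FP.splitAt-↑ˡ (nV G) v M.card)) (VP.[]=⇒lookup v∈e)))
      where
      v   = proj₁ (nonempty G e)
      v∈e = proj₂ (nonempty G e)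

  G′ : Hypergraph
  G′ = hyp (nV G + M.card) (nE G) (λ e → Vec.tabulate (memᶠ e)) memᶠ-nonempty

  private
    mem-old : ∀ e v → mem G′ e (v ↑ˡ M.card) ≡ mem G e v
    mem-old e v = trans (VP.lookup∘tabulate (memᶠ e) (v ↑ˡ M.card))
                        (cong [ mem G e , _ ]′ (FP.splitAt-↑ˡ (nV G) v M.card))

    mem-new : ∀ e i → mem G′ e (nV G ↑ʳ i) ≡ eqᶠ (newEdge i) e
    mem-new e i = trans (VP.lookup∘tabulate (memᶠ e) (nV G ↑ʳ i))
                        (cong [ mem G e , _ ]′ (FP.splitAt-↑ʳ (nV G) M.card i))

    view : ∀ x → (∃ λ v → v ↑ˡ M.card ≡ x) ⊎ (∃ λ i → nV G ↑ʳ i ≡ x)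
    view x with splitAt (nV G) x in q
    ... | inj₁ v = inj₁ (v , FP.splitAt⁻¹-↑ˡ q)
    ... | inj₂ i = inj₂ (i , FP.splitAt⁻¹-↑ʳ q)

  gV : VMap G G′
  gV v = v ↑ˡ M.card

  gE : EMap G G′
  gE = id

  kV : VMap G′ H
  kV x = [ hV , newImage ]′ (splitAt (nV G) x)

  kE : EMap G′ H
  kE = hE

  private
    kV-old : ∀ v → kV (v ↑ˡ M.card) ≡ hV v
    kV-old v = cong [ hV , newImage ]′ (FP.splitAt-↑ˡ (nV G) v M.card)

    kV-new : ∀ i → kV (nV G ↑ʳ i) ≡ newImage i
    kV-new i = cong [ hV , newImage ]′ (FP.splitAt-↑ʳ (nV G) M.card i)

    new-incident : ∀ i → Holds (mem H (hE (newEdge i)) (newImage i))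
    new-incident i = ∧-projˡ (M.embed-sat i)

    new-missing : ∀ i v → Holds (mem G (newEdge i) v) → hV v ≢ newImage i
    new-missing i v m q =
      not-elim (∧-projʳ {mem H (hE (newEdge i)) (newImage i)} (M.embed-sat i)) (anyᵇ-intro v (∧-intro m (≡⇒eqᶠ q)))

    new-edge : ∀ {e i} → Holds (mem G′ e (nV G ↑ʳ i)) → newEdge i ≡ e
    new-edge {e} {i} m = eqᶠ⇒≡ (subst Holds (mem-new e i) m)

  g : IsLeafAddInHom G G′ gV gE
  g = record
    { inHom  = λ e v m → subst Holds (sym (mem-old e v)) m
    ; strong = λ e v m → subst Holds (mem-old e v) m
    ; injV   = FP.↑ˡ-injective M.card _ _
    ; injE   = id
    ; surjE  = λ ε → ε , refl
    ; leaves = leaves }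
    where
    leaves : HasLeafComplement G G′ gV gE
    leaves w ∉img with view w
    ... | inj₁ (v , q)    = ⊥-elim (∉img v q)
    ... | inj₂ (i , refl) = countᵇ≡1-intro (newEdge i)
      (subst Holds (sym (mem-new (newEdge i) i)) (≡⇒eqᶠ {x = newEdge i} refl)) (λ e m → sym (new-edge m))

  k : IsLoInjHom G′ H kV kE
  k = record { inHom = inHom ; onto = onto ; locInj = locInj }
    where
    inHom : IsInHom G′ H kV kE
    inHom e x m with view x
    ... | inj₁ (v , refl) = subst (λ z → Holds (mem H (hE e) z)) (sym (kV-old v))
                                  (h.inHom e v (subst Holds (mem-old e v) m))
    ... | inj₂ (i , refl) = subst₂ (λ a b → Holds (mem H (hE a) b)) (new-edge m) (sym (kV-new i)) (new-incident i)

    onto : IsOnto G′ H kV kE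
    onto e w m with anyᵇ (nV G) (λ v → mem G e v ∧ eqᶠ (hV v) w) in covered
    ... | true  = let (v , r) = anyᵇ-elim covered in
      gV v , subst Holds (sym (mem-old e v)) (∧-projˡ r) , trans (kV-old v) (eqᶠ⇒≡ (∧-projʳ {mem G e v} r))
    ... | false = nV G ↑ʳ i , subst Holds (sym (mem-new e i)) (≡⇒eqᶠ edge≡) , trans (kV-new i) image≡
      where
      pair≡ : pair (Fin.combine e w) ≡ (e , w)
      pair≡ = FP.remQuot-combine e w
      found = M.embed-onto (Fin.combine e w)
        (subst (Holds ∘ missingᵇ) (sym pair≡) (∧-intro m (not-intro (false⇒¬Holds covered))))
      i = proj₁ found
      edge≡ : newEdge i ≡ e
      edge≡ = trans (cong (proj₁ ∘ pair) (proj₂ found)) (cong proj₁ pair≡)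
      image≡ : newImage i ≡ w
      image≡ = trans (cong (proj₂ ∘ pair) (proj₂ found)) (cong proj₂ pair≡)

    locInj : IsLocInj G′ H kV kE
    locInj e x x′ m m′ q with view x | view x′
    ... | inj₁ (v , refl) | inj₁ (v′ , refl) =
      cong gV (h.locInj e v v′ (subst Holds (mem-old e v) m) (subst Holds (mem-old e v′) m′)
                               (trans (sym (kV-old v)) (trans q (kV-old v′))))
    ... | inj₁ (v , refl) | inj₂ (i , refl) =
      ⊥-elim (new-missing i v (subst (λ z → Holds (mem G z v)) (sym (new-edge m′)) (subst Holds (mem-old e v) m))
                              (trans (sym (kV-old v)) (trans q (kV-new i))))
    ... | inj₂ (i , refl) | inj₁ (v , refl) =
      ⊥-elim (new-missing i v (subst (λ z → Holds (mem G z v)) (sym (new-edge m)) (subst Holds (mem-old e v) m′))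
                              (trans (sym (kV-old v)) (trans (sym q) (kV-new i))))
    ... | inj₂ (i , refl) | inj₂ (i′ , refl) = cong (nV G ↑ʳ_) (M.embed-injective (begin
        M.embed i                           ≡⟨ sym (FP.combine-remQuot {nE G} (nV H) (M.embed i)) ⟩
        Fin.combine (newEdge i) (newImage i)   ≡⟨ cong₂ Fin.combine (trans (new-edge m) (sym (new-edge m′)))
                                                                    (trans (sym (kV-new i)) (trans q (kV-new i′))) ⟩
        Fin.combine (newEdge i′) (newImage i′) ≡⟨ FP.combine-remQuot {nE G} (nV H) (M.embed i′) ⟩
        M.embed i′                          ∎))
      where open ≡-Reasoning

  factorV : ∀ v → hV v ≡ kV (gV v)
  factorV v = sym (kV-old v)

  size-G′ : size G′ ≤ nV G + nE G * nV H + nE G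
  size-G′ = ℕP.+-monoˡ-≤ (nE G) (ℕP.+-monoʳ-≤ (nV G) M.card≤n)

  connected : Connected G → Connected G′
  connected G-conn x y = to-old x .proj₂ .proj₁ ◅◅ gmap lift lift-adj (G-conn _ _) ◅◅ to-old y .proj₂ .proj₂
    where
    lift : Node G → Node G′
    lift (inj₁ v) = inj₁ (gV v)
    lift (inj₂ e) = inj₂ e

    lift-adj : ∀ {a b} → IncAdj G a b → IncAdj G′ (lift a) (lift b)
    lift-adj (v-e {v} {e} m) = v-e (trans (mem-old e v) m)
    lift-adj (e-v {v} {e} m) = e-v (trans (mem-old e v) m)

    to-old : ∀ x → ∃ λ a → Star (IncAdj G′) x (lift a) × Star (IncAdj G′) (lift a) x
    to-old (inj₂ e) = inj₂ e , Star.ε , Star.ε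
    to-old (inj₁ x) with view x
    ... | inj₁ (v , refl) = inj₁ v , Star.ε , Star.ε
    ... | inj₂ (i , refl) = inj₂ (newEdge i) , v-e m ◅ Star.ε , e-v m ◅ Star.ε
      where m = trans (mem-new (newEdge i) i) (≡⇒eqᶠ {x = newEdge i} refl)

module _ (G H : Hypergraph) where
  open Fibre G H using (fibre; fibre≢0⇒∃; toFactorisation; InFibre; inFibreᵇ⁺; inFibreᵇ-resp)

  fibres-iso : ∀ A B h → fibre A h ≢ 0 → fibre B h ≢ 0 → Iso A B
  fibres-iso A B h ne ne′ = CI.σV , CI.σE , isIso⁺ A B CI.σV CI.σE CI.σ-isIsomorphism
    where
    module FA = Fibre G H A
    module FB = Fibre G H B
    w  = proj₂ (fibre≢0⇒∃ A h ne)
    w′ = proj₂ (fibre≢0⇒∃ B h ne′)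
    cV = λ v → trans (sym (FA.InFibre.factorV w v)) (FB.InFibre.factorV w′ v)
    cE = λ e → trans (sym (FA.InFibre.factorE w e)) (FB.InFibre.factorE w′ e)
    module C  = Comparison (toFactorisation A w) (toFactorisation B w′) cV cE
    module C′ = Comparison (toFactorisation B w′) (toFactorisation A w) (sym ∘ cV) (sym ∘ cE)
    module CI = ComparisonIso (toFactorisation A w) (toFactorisation B w′) cV cE
                  (proj₁ ∘ C.matchV-exists) (proj₁ ∘ C.matchE-exists)
                  (proj₁ ∘ C′.matchV-exists) (proj₁ ∘ C′.matchE-exists)

  levelBound : ℕ
  levelBound = suc (nV G + nE G * nV H + nE G)

  fibre-nonempty : (R : RepSystem) → Connected G → ∀ h → IsLoInjInHom G H (proj₁ h) (proj₂ h) →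
    ∃ λ a → level {R} a < levelBound × fibre (rep R a) h ≢ 0
  fibre-nonempty R G-conn (hV , hE) h = a , level<bound ,
    countᴱ-pos (Fibre.Composable G H A) (Fibre.inFibreᵇ G H A (hV , hE)) (inFibreᵇ-resp A (hV , hE)) q
               (inFibreᵇ⁺ A (hV , hE) q w)
    where
    module L = LeafExtension G H hV hE h
    complete = reps-complete R L.G′ (L.connected G-conn)
    a = proj₁ complete , proj₁ (proj₂ complete)
    A = rep R a
    tV = proj₁ (proj₂ (proj₂ complete))
    tE = proj₁ (proj₂ (proj₂ (proj₂ complete)))
    t : IsIsomorphism L.G′ A tV tE
    t = isIso⁻ L.G′ A tV tE (proj₂ (proj₂ (proj₂ (proj₂ complete))))
    level<bound : level {R} a < levelBound
    level<bound = subst (_< levelBound) (trans (iso-size t) (reps-size R _ _)) (s≤s L.size-G′)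
    module T = AlongIsomorphism {G} {L.G′} {A} {H} t (proj₁ ∘ IsIsomorphism.surjV t) (proj₁ ∘ IsIsomorphism.surjE t)
    q : Carrier (Fibre.Composable G H A)
    q = (tV ∘ L.gV , tE ∘ L.gE) , (L.kV ∘ T.sV , L.kE ∘ T.sE)
    w : InFibre A (hV , hE) q
    w = record
      { leafAdd  = T.postcompose L.g
      ; loInjHom = T.precompose L.k
      ; factorV  = λ v → trans (L.factorV v) (cong L.kV (sym (T.stV (L.gV v))))
      ; factorE  = λ e → cong L.kE (sym (T.stE (L.gE e))) }

-- The counting identity

toℚ-mkℚ : ∀ n → toℚ n ≡ ℚ.mkℚ (ℤ.+ n) 0 (Cop.sym (Cop.1-coprimeTo n))
toℚ-mkℚ n = ℚP.normalize-coprime (Cop.sym (Cop.1-coprimeTo n))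

toℚ-+ : ∀ m n → toℚ (m + n) ≡ toℚ m ℚ.+ toℚ n
toℚ-+ m n rewrite toℚ-mkℚ m | toℚ-mkℚ n =
  cong (ℚ._/ 1) (trans (ℤP.pos-+ m n) (sym (cong₂ ℤ._+_ (ℤP.*-identityʳ (ℤ.+ m)) (ℤP.*-identityʳ (ℤ.+ n)))))

toℚ-* : ∀ m n → toℚ (m * n) ≡ toℚ m ℚ.* toℚ n
toℚ-* m n rewrite toℚ-mkℚ m | toℚ-mkℚ n = cong (ℚ._/ 1) (ℤP.pos-* m n)

toℚ≡0⇒≡0 : ∀ n → toℚ n ≡ 0ℚ → n ≡ 0
toℚ≡0⇒≡0 zero    e = refl
toℚ≡0⇒≡0 (suc n) e with () ← cong ℚ.numerator (trans (sym (toℚ-mkℚ (suc n))) e)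

toℚ*invℕ : ∀ n → n ≢ 0 → toℚ n ℚ.* invℕ n ≡ 1ℚ
toℚ*invℕ zero    n≢0 = ⊥-elim (n≢0 refl)
toℚ*invℕ (suc n) _ rewrite toℚ-mkℚ (suc n) | ℚP.normalize-coprime (Cop.1-coprimeTo (suc n)) =
  ℚP.*-inverseʳ (ℚ.mkℚ (ℤ.+ suc n) 0 (Cop.sym (Cop.1-coprimeTo (suc n))))

cancel-invℕ : ∀ L M A S → A ≢ 0 → L * M ≡ A * S → toℚ L ℚ.* invℕ A ℚ.* toℚ M ≡ toℚ S
cancel-invℕ L M A S A≢0 LM≡AS = begin
    toℚ L ℚ.* invℕ A ℚ.* toℚ M
  ≡⟨ solve 3 (λ l i m → l :* i :* m := (l :* m) :* i) refl (toℚ L) (invℕ A) (toℚ M) ⟩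
    toℚ L ℚ.* toℚ M ℚ.* invℕ A
  ≡⟨ cong (ℚ._* invℕ A) (trans (sym (toℚ-* L M)) (trans (cong toℚ LM≡AS) (toℚ-* A S))) ⟩
    toℚ A ℚ.* toℚ S ℚ.* invℕ A
  ≡⟨ solve 3 (λ a s i → a :* s :* i := (a :* i) :* s) refl (toℚ A) (toℚ S) (invℕ A) ⟩
    toℚ A ℚ.* invℕ A ℚ.* toℚ S
  ≡⟨ cong (ℚ._* toℚ S) (toℚ*invℕ A A≢0) ⟩
    1ℚ ℚ.* toℚ S
  ≡⟨ ℚP.*-identityˡ (toℚ S) ⟩
    toℚ S
  ∎
  where
  open ≡-Reasoning
  open ℚSolver using (solve; _:*_; _:=_)

toℚ-∑ : {X : Set} (xs : List X) (f : X → ℕ) → toℚ (∑ xs f) ≡ ℚΣ.∑ xs (toℚ ∘ f)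
toℚ-∑ []       f = refl
toℚ-∑ (x ∷ xs) f = trans (toℚ-+ (f x) (∑ xs f)) (cong (toℚ (f x) ℚ.+_) (toℚ-∑ xs f))

sumBelow≡∑< : (R : RepSystem) → ∀ n F → sumBelow R n F ≡ ℚΣ.Levels.∑< R n F
sumBelow≡∑< R zero    F = refl
sumBelow≡∑< R (suc n) F = cong (ℚ._+ ℚΣ.Levels.row R n F) (sumBelow≡∑< R n F)

toℚ-∑< : (R : RepSystem) → ∀ n (F : Index R → ℕ) → toℚ (Levels.∑< R n F) ≡ sumBelow R n (toℚ ∘ F)
toℚ-∑< R zero    F = refl
toℚ-∑< R (suc n) F =
  trans (toℚ-+ (Levels.∑< R n F) _)
        (cong₂ ℚ._+_ (toℚ-∑< R n F) (toℚ-∑ (allFin (length (reps R n))) (λ i → F (n , i))))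

rep-injective : (R : RepSystem) → ∀ a b → Iso (rep R a) (rep R b) → a ≡ b
rep-injective R (k , i) (l , j) iso with reps-distinct R k l i j iso
... | refl , refl = refl

Aut≢0 : ∀ A → Aut A ≢ 0
Aut≢0 A Aut≡0 = countᴱ-pos (Maps A A) (isoᵇ A A) (isoᵇ-resp A A) (id , id) (isIso⁺ A A id id (id-isIsomorphism A))
                           (trans (sym (count≡countᴱ A A (isIso A A))) Aut≡0)

sgn : ℕ → ℕ
sgn zero    = 0
sgn (suc _) = 1

sgn-≢0 : ∀ {n} → n ≢ 0 → sgn n ≡ 1
sgn-≢0 {zero}  n≢0 = ⊥-elim (n≢0 refl)
sgn-≢0 {suc n} _   = refl

n≡m*sgn[n] : ∀ n m → (n ≢ 0 → n ≡ m) → n ≡ m * sgn n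
n≡m*sgn[n] zero    m _  = sym (ℕP.*-zeroʳ m)
n≡m*sgn[n] (suc n) m eq = trans (eq (λ ())) (sym (ℕP.*-identityʳ m))

module MainIdentity (R : RepSystem) (G H : Hypergraph) (G-conn : Connected G) where
  private
    open module ℕLevels = Levels R using (∑<)
    GHs = elems (Maps G H)

  fibre : Index R → Map G H → ℕ
  fibre a = Fibre.fibre G H (rep R a)

  nonemptyFibres : Index R → ℕ
  nonemptyFibres a = ∑ GHs (λ h → sgn (fibre a h))

  fibre-unique : ∀ {a b} h → fibre a h ≢ 0 → fibre b h ≢ 0 → a ≡ b
  fibre-unique {a} {b} h ne ne′ = rep-injective R a b (fibres-iso G H (rep R a) (rep R b) h ne ne′)

  LeafAddInHom*LoInjHom≡Aut*nonemptyFibres : ∀ a →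
    LeafAddInHom G (rep R a) * LoInjHom (rep R a) H ≡ Aut (rep R a) * nonemptyFibres a
  LeafAddInHom*LoInjHom≡Aut*nonemptyFibres a = begin
      LeafAddInHom G A * LoInjHom A H
    ≡⟨ Fibre.LeafAddInHom*LoInjHom≡∑fibre G H A ⟩
      ∑ GHs (fibre a)
    ≡⟨ ∑-cong GHs (λ h → n≡m*sgn[n] (fibre a h) (Aut A) (Fibre.fibre≢0⇒≡Aut G H A h)) ⟩
      ∑ GHs (λ h → Aut A * sgn (fibre a h))
    ≡⟨ ∑-*ˡ GHs (Aut A) _ ⟩
      Aut A * nonemptyFibres a
    ∎
    where
    open ≡-Reasoning
    A = rep R a

  term≡nonemptyFibres : ∀ a → term R G H a ≡ toℚ (nonemptyFibres a)
  term≡nonemptyFibres a = cancel-invℕ (LeafAddInHom G (rep R a)) (LoInjHom (rep R a) H) (Aut (rep R a)) (nonemptyFibres a)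
                                 (Aut≢0 (rep R a)) (LeafAddInHom*LoInjHom≡Aut*nonemptyFibres a)

  loInjInHomᵇ : Map G H → Bool
  loInjInHomᵇ (hV , hE) = isInHom G H hV hE ∧ isLocInj G H hV hE

  ∑<sgn[fibre]≡⟦loInjInHom⟧ : ∀ h → ∑< (levelBound G H) (λ a → sgn (fibre a h)) ≡ ⟦ loInjInHomᵇ h ⟧
  ∑<sgn[fibre]≡⟦loInjInHom⟧ h with loInjInHomᵇ h in isLoInj
  ... | true = trans (ℕLevels.∑<-δ _ _ a₀ off level<) (sgn-≢0 ne₀)
    where
    found = fibre-nonempty G H R G-conn h (isLoInjInHom⁻ G H (proj₁ h) (proj₂ h) isLoInj)
    a₀ = proj₁ found
    level< = proj₁ (proj₂ found)
    ne₀ = proj₂ (proj₂ found)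
    off : ∀ a → _ → a ≢ a₀ → sgn (fibre a h) ≡ 0
    off a _ a≢a₀ with fibre a h ℕ.≟ 0
    ... | yes fibre≡0 = cong sgn fibre≡0
    ... | no  ne     = ⊥-elim (a≢a₀ (fibre-unique h ne ne₀))
  ... | false = ℕLevels.∑<-zero _ _ (λ a _ → empty a)
    where
    empty : ∀ a → sgn (fibre a h) ≡ 0
    empty a with fibre a h ℕ.≟ 0
    ... | yes fibre≡0 = cong sgn fibre≡0
    ... | no  ne     = ⊥-elim (false⇒¬Holds isLoInj
      (isLoInjInHom⁺ G H (proj₁ h) (proj₂ h) (Fibre.fibre≢0⇒isLoInjInHom G H (rep R a) h ne)))

  identity : toℚ (LoInjInHom G H) ≡ sumBelow R (levelBound G H) (term R G H)
  identity = begin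
      toℚ (LoInjInHom G H)
    ≡⟨ cong toℚ (count≡countᴱ G H _) ⟩
      toℚ (∑ GHs (λ h → ⟦ loInjInHomᵇ h ⟧))
    ≡⟨ cong toℚ (∑-cong GHs (λ h → sym (∑<sgn[fibre]≡⟦loInjInHom⟧ h))) ⟩
      toℚ (∑ GHs (λ h → ∑< (levelBound G H) (λ a → sgn (fibre a h))))
    ≡⟨ cong toℚ (sym (ℕLevels.∑<-∑-swap (levelBound G H) GHs (λ a h → sgn (fibre a h)))) ⟩
      toℚ (∑< (levelBound G H) nonemptyFibres)
    ≡⟨ toℚ-∑< R (levelBound G H) nonemptyFibres ⟩
      sumBelow R (levelBound G H) (toℚ ∘ nonemptyFibres)
    ≡⟨ sumBelow≡∑< R (levelBound G H) _ ⟩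
      ℚΣ.Levels.∑< R (levelBound G H) (toℚ ∘ nonemptyFibres)
    ≡⟨ ℚΣ.Levels.∑<-cong R (levelBound G H) (λ a _ → sym (term≡nonemptyFibres a)) ⟩
      ℚΣ.Levels.∑< R (levelBound G H) (term R G H)
    ≡⟨ sym (sumBelow≡∑< R (levelBound G H) _) ⟩
      sumBelow R (levelBound G H) (term R G H)
    ∎
    where open ≡-Reasoning

  term-vanishes : (a : Index R) → levelBound G H ≤ level {R} a → term R G H a ≡ 0ℚ
  term-vanishes a bound≤level = trans (term≡nonemptyFibres a) (cong toℚ (∑-zero GHs _ empty))
    where
    empty : ∀ h → sgn (fibre a h) ≡ 0
    empty h with fibre a h ℕ.≟ 0
    ... | yes fibre≡0 = cong sgn fibre≡0
    ... | no  ne     = ⊥-elim (ℕP.<⇒≱ (subst (λ b → level {R} b < levelBound G H) (fibre-unique h ne₀ ne) level<)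
                                      bound≤level)
      where
      found = fibre-nonempty G H R G-conn h (Fibre.fibre≢0⇒isLoInjInHom G H (rep R a) h ne)
      level< = proj₁ (proj₂ found)
      ne₀ = proj₂ (proj₂ found)

-- Inverting upper triangular matrices

module UpperTriangularInverse (R : RepSystem) where
  open ℚΣ.Levels R
  private
    lev : Index R → ℕ
    lev = level {R}

  _≟ᴵ_ : (a b : Index R) → Dec (a ≡ b)
  (k , i) ≟ᴵ (l , j) with k ℕ.≟ l
  ... | no k≢l = no λ { refl → k≢l refl }
  ... | yes refl with i FP.≟ j
  ... | yes refl = yes refl
  ... | no i≢j  = no λ { refl → i≢j refl }

  δ : Index R → Index R → ℚ → ℚ
  δ a b x with a ≟ᴵ b
  ... | yes _ = x
  ... | no  _ = 0ℚ

  δ-same : ∀ a x → δ a a x ≡ x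
  δ-same a x with a ≟ᴵ a
  ... | yes _   = refl
  ... | no a≢a = ⊥-elim (a≢a refl)

  δ-diff : ∀ a b x → a ≢ b → δ a b x ≡ 0ℚ
  δ-diff a b x a≢b with a ≟ᴵ b
  ... | yes a≡b = ⊥-elim (a≢b a≡b)
  ... | no  _   = refl

  upperTriangular-zero : ∀ {X} → UpperTriangular R X → ∀ a c → a ≢ c → ¬ (lev a < lev c) → X a c ≡ 0ℚ
  upperTriangular-zero {X} ut a c a≢c ≮ with X a c ℚP.≟ 0ℚ
  ... | yes X≡0 = X≡0
  ... | no  X≢0 with ut a c X≢0
  ... | inj₁ a≡c = ⊥-elim (a≢c a≡c)
  ... | inj₂ a<c = ⊥-elim (≮ a<c)

  ∑<-split : ∀ n F G a₀ → (∀ c → lev c < n → c ≢ a₀ → F c ≡ G c) → lev a₀ < n →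
    ∑< n F ≡ ∑< n G ℚ.+ (F a₀ ℚ.- G a₀)
  ∑<-split n F G a₀ F≡G a₀<n = begin
      ∑< n F
    ≡⟨ ∑<-cong n (λ c _ → solve 2 (λ x y → x := y :+ (x :- y)) refl (F c) (G c)) ⟩
      ∑< n (λ c → G c ℚ.+ (F c ℚ.- G c))
    ≡⟨ ∑<-distrib-+ n G (λ c → F c ℚ.- G c) ⟩
      ∑< n G ℚ.+ ∑< n (λ c → F c ℚ.- G c)
    ≡⟨ cong (∑< n G ℚ.+_) (∑<-δ n _ a₀ (λ c c<n c≢a₀ → trans (cong (ℚ._- G c) (F≡G c c<n c≢a₀))
                                                              (ℚP.+-inverseʳ (G c))) a₀<n) ⟩
      ∑< n G ℚ.+ (F a₀ ℚ.- G a₀)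
    ∎
    where
    open ≡-Reasoning
    open ℚSolver using (solve; _:+_; _:-_; _:=_)

  module _ (M : Index R → Index R → ℚ) (ut : UpperTriangular R M) (diag≢0 : ∀ a → M a a ≢ 0ℚ) where

    pivot⁻¹ : Index R → ℚ
    pivot⁻¹ a = (ℚ.1/ M a a) {{ℚ.≢-nonZero (diag≢0 a)}}

    pivot*pivot⁻¹ : ∀ a → M a a ℚ.* pivot⁻¹ a ≡ 1ℚ
    pivot*pivot⁻¹ a = ℚP.*-inverseʳ (M a a) {{ℚ.≢-nonZero (diag≢0 a)}}

    -- Back substitution for column b: after t rounds the entries in rows d with
    -- lev d + t ≥ lev b are final; round t+1 fills the rows with lev d + (t + 1) = lev b.
    column : Index R → ℕ → Index R → ℚ
    column b zero    d = δ d b (pivot⁻¹ b)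
    column b (suc t) d = if (lev d + suc t) ℕ.≡ᵇ lev b
                         then ℚ.- (pivot⁻¹ d ℚ.* ∑< (suc (lev b)) (λ e → M d e ℚ.* column b t e))
                         else column b t d

    column-fill : ∀ b t d → lev d + suc t ≡ lev b →
      column b (suc t) d ≡ ℚ.- (pivot⁻¹ d ℚ.* ∑< (suc (lev b)) (λ e → M d e ℚ.* column b t e))
    column-fill b t d eq with (lev d + suc t) ℕ.≡ᵇ lev b in eqᵇ
    ... | true  = refl
    ... | false = ⊥-elim (subst Bool.T eqᵇ (ℕP.≡⇒≡ᵇ _ _ eq))

    column-keep : ∀ b t d → lev d + suc t ≢ lev b → column b (suc t) d ≡ column b t d
    column-keep b t d ne with (lev d + suc t) ℕ.≡ᵇ lev b in eqᵇ
    ... | true  = ⊥-elim (ne (ℕP.≡ᵇ⇒≡ _ _ (subst Bool.T (sym eqᵇ) tt)))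
    ... | false = refl

    column-zero : ∀ b t d → d ≢ b → lev b ≤ lev d ⊎ lev d + t < lev b → column b t d ≡ 0ℚ
    column-zero b zero    d d≢b _ = δ-diff d b (pivot⁻¹ b) d≢b
    column-zero b (suc t) d d≢b (inj₁ b≤d) =
      trans (column-keep b t d (λ eq → ℕP.<-irrefl (sym eq) (ℕP.≤-<-trans b≤d (ℕP.m<m+n (lev d) (s≤s z≤n)))))
            (column-zero b t d d≢b (inj₁ b≤d))
    column-zero b (suc t) d d≢b (inj₂ d+t<b) =
      trans (column-keep b t d (λ eq → ℕP.<-irrefl eq d+t<b))
            (column-zero b t d d≢b (inj₂ (ℕP.<-trans (ℕP.+-monoʳ-< (lev d) (ℕP.n<1+n t)) d+t<b)))

    column-stable : ∀ b t s d → lev b ≤ lev d + t → column b (t + s) d ≡ column b t d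
    column-stable b t zero    d _ rewrite ℕP.+-identityʳ t = refl
    column-stable b t (suc s) d b≤d+t rewrite ℕP.+-suc t s =
      trans (column-keep b (t + s) d (λ eq → ℕP.<-irrefl (sym eq) b<)) (column-stable b t s d b≤d+t)
      where
      b< : lev b < lev d + suc (t + s)
      b< = ℕP.≤-<-trans b≤d+t (ℕP.+-monoʳ-< (lev d) (s≤s (ℕP.m≤m+n t s)))

    inverse : Index R → Index R → ℚ
    inverse d b = column b (lev b) d

    inverse≡column : ∀ b t d → lev b ≤ lev d + t → t ≤ lev b → inverse d b ≡ column b t d
    inverse≡column b t d b≤d+t t≤b =
      trans (cong (λ z → column b z d) (sym (ℕP.m+[n∸m]≡n t≤b))) (column-stable b t (lev b ℕ.∸ t) d b≤d+t)

    inverse-upperTriangular : UpperTriangular R inverse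
    inverse-upperTriangular a b nz with a ≟ᴵ b
    ... | yes a≡b = inj₁ a≡b
    ... | no  a≢b with lev a ℕ.<? lev b
    ... | yes a<b = inj₂ a<b
    ... | no  a≮b = ⊥-elim (nz (column-zero b (lev b) a a≢b (inj₁ (ℕP.≮⇒≥ a≮b))))

    private
      pivot-cancel : ∀ m i S → m ℚ.* i ≡ 1ℚ → S ℚ.+ (m ℚ.* (ℚ.- (i ℚ.* S)) ℚ.- m ℚ.* 0ℚ) ≡ 0ℚ
      pivot-cancel m i S m*i≡1 = begin
          S ℚ.+ (m ℚ.* (ℚ.- (i ℚ.* S)) ℚ.- m ℚ.* 0ℚ)
        ≡⟨ solve 3 (λ m i S → S :+ (m :* (:- (i :* S)) :- m :* con 0ℚ) := S :- (m :* i) :* S) refl m i S ⟩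
          S ℚ.- (m ℚ.* i) ℚ.* S
        ≡⟨ cong (λ z → S ℚ.- z ℚ.* S) m*i≡1 ⟩
          S ℚ.- 1ℚ ℚ.* S
        ≡⟨ solve 1 (λ S → S :- con 1ℚ :* S := con 0ℚ) refl S ⟩
          0ℚ
        ∎
        where
        open ≡-Reasoning
        open ℚSolver using (solve; _:+_; _:*_; _:-_; :-_; _:=_; con)

      pivot-injective : ∀ m i x d B → m ℚ.* i ≡ 1ℚ → B ≡ B ℚ.+ (m ℚ.* x ℚ.- m ℚ.* d) → x ≡ d
      pivot-injective m i x d B m*i≡1 B≡ = begin
          x
        ≡⟨ solve 4 (λ m x d i → x := d :+ i :* (m :* x :- m :* d) :+ (con 1ℚ :- m :* i) :* (x :- d)) refl m x d i ⟩
          d ℚ.+ i ℚ.* y ℚ.+ (1ℚ ℚ.- m ℚ.* i) ℚ.* (x ℚ.- d)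
        ≡⟨ cong₂ (λ u v → d ℚ.+ i ℚ.* u ℚ.+ (1ℚ ℚ.- v) ℚ.* (x ℚ.- d)) y≡0 m*i≡1 ⟩
          d ℚ.+ i ℚ.* 0ℚ ℚ.+ (1ℚ ℚ.- 1ℚ) ℚ.* (x ℚ.- d)
        ≡⟨ solve 3 (λ d i z → d :+ i :* con 0ℚ :+ (con 1ℚ :- con 1ℚ) :* z := d) refl d i (x ℚ.- d) ⟩
          d
        ∎
        where
        open ≡-Reasoning
        open ℚSolver using (solve; _:+_; _:*_; _:-_; _:=_; con)
        y = m ℚ.* x ℚ.- m ℚ.* d
        y≡0 : y ≡ 0ℚ
        y≡0 = trans (solve 2 (λ B y → y := (B :+ y) :- B) refl B y) (trans (cong (ℚ._- B) (sym B≡)) (ℚP.+-inverseʳ B))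

    M*-belowDiagonal : ∀ {a c} x → c ≢ a → lev c ≤ lev a → M a c ℚ.* x ≡ 0ℚ
    M*-belowDiagonal {a} {c} x c≢a c≤a =
      trans (cong (ℚ._* x) (upperTriangular-zero ut a c (c≢a ∘ sym) (ℕP.≤⇒≯ c≤a))) (ℚP.*-zeroˡ x)

    M*-cong-aboveDiagonal : ∀ {a c x y} → c ≢ a → (lev a < lev c → x ≡ y) → M a c ℚ.* x ≡ M a c ℚ.* y
    M*-cong-aboveDiagonal {a} {c} {x} {y} c≢a x≡y with M a c ℚP.≟ 0ℚ
    ... | yes M≡0 rewrite M≡0 = trans (ℚP.*-zeroˡ x) (sym (ℚP.*-zeroˡ y))
    ... | no  M≢0 with ut a c M≢0
    ... | inj₁ a≡c = ⊥-elim (c≢a (sym a≡c))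
    ... | inj₂ a<c = cong (M a c ℚ.*_) (x≡y a<c)

    M*inverse : ∀ a b → ∑< (suc (lev b)) (λ c → M a c ℚ.* inverse c b) ≡ δ a b 1ℚ
    M*inverse a b with ℕP.<-cmp (lev a) (lev b)
    ... | tri> _ _ b<a =
      trans (∑<-zero (suc (lev b)) _ (λ c c≤b → let c<a = ℕP.≤-<-trans (ℕP.≤-pred c≤b) b<a in
                                        M*-belowDiagonal (inverse c b) (λ { refl → ℕP.<-irrefl refl c<a }) (ℕP.<⇒≤ c<a)))
            (sym (δ-diff a b 1ℚ (λ { refl → ℕP.<-irrefl refl b<a })))
    ... | tri≈ _ a≈b _ =
      trans (∑<-δ (suc (lev b)) _ a (λ c c≤b c≢a → M*-belowDiagonal (inverse c b) c≢a
                                                     (subst (lev c ≤_) (sym a≈b) (ℕP.≤-pred c≤b)))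
                  (s≤s (ℕP.≤-reflexive a≈b)))
            diagonal
      where
      diagonal : M a a ℚ.* inverse a b ≡ δ a b 1ℚ
      diagonal with a ≟ᴵ b
      ... | yes refl = trans (cong (M a a ℚ.*_) (trans (inverse≡column a 0 a (ℕP.m≤m+n (lev a) 0) z≤n)
                                                       (δ-same a (pivot⁻¹ a)))) (pivot*pivot⁻¹ a)
      ... | no a≢b = trans (cong (M a a ℚ.*_) (column-zero b (lev b) a a≢b (inj₁ (ℕP.≤-reflexive (sym a≈b)))))
                           (ℚP.*-zeroʳ (M a a))
    ... | tri< a<b _ _ = begin
        ∑< (suc (lev b)) (λ c → M a c ℚ.* inverse c b)
      ≡⟨ ∑<-split (suc (lev b)) _ (λ c → M a c ℚ.* column b t c) a agree (s≤s (ℕP.<⇒≤ a<b)) ⟩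
        S ℚ.+ (M a a ℚ.* inverse a b ℚ.- M a a ℚ.* column b t a)
      ≡⟨ cong₂ (λ x y → S ℚ.+ (M a a ℚ.* x ℚ.- M a a ℚ.* y)) inverse-a column-a ⟩
        S ℚ.+ (M a a ℚ.* (ℚ.- (pivot⁻¹ a ℚ.* S)) ℚ.- M a a ℚ.* 0ℚ)
      ≡⟨ pivot-cancel (M a a) (pivot⁻¹ a) S (pivot*pivot⁻¹ a) ⟩
        0ℚ
      ≡⟨ sym (δ-diff a b 1ℚ a≢b) ⟩
        δ a b 1ℚ
      ∎
      where
      open ≡-Reasoning
      a≢b : a ≢ b
      a≢b refl = ℕP.<-irrefl refl a<b
      t = lev b ℕ.∸ suc (lev a)
      a+1+t≡b : lev a + suc t ≡ lev b
      a+1+t≡b = trans (ℕP.+-suc (lev a) t) (ℕP.m+[n∸m]≡n a<b)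
      S = ∑< (suc (lev b)) (λ e → M a e ℚ.* column b t e)
      agree : ∀ c → lev c < suc (lev b) → c ≢ a → M a c ℚ.* inverse c b ≡ M a c ℚ.* column b t c
      agree c _ c≢a = M*-cong-aboveDiagonal c≢a λ a<c → inverse≡column b t c
        (subst (_≤ lev c + t) a+1+t≡b (subst (_≤ lev c + t) (sym (ℕP.+-suc (lev a) t)) (ℕP.+-monoˡ-≤ t a<c)))
        (ℕP.m∸n≤m (lev b) (suc (lev a)))
      column-a : column b t a ≡ 0ℚ
      column-a = column-zero b t a a≢b (inj₂ (subst (lev a + t <_) a+1+t≡b (ℕP.+-monoʳ-< (lev a) (ℕP.n<1+n t))))
      inverse-a : inverse a b ≡ ℚ.- (pivot⁻¹ a ℚ.* S)
      inverse-a = trans (inverse≡column b (suc t) a (ℕP.≤-reflexive (sym a+1+t≡b))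
                                        (subst (suc t ≤_) a+1+t≡b (ℕP.m≤n+m (suc t) (lev a))))
                        (column-fill b t a a+1+t≡b)

    -- Column b of inverse * M solves the upper triangular system M X = M e_b, whose solution
    -- is unique: descending in level, each entry is determined by the ones above it.
    module LeftInverse (b : Index R) where
      private
        n : ℕ
        n = suc (lev b)

      X : Index R → ℚ
      X a = ∑< n (λ c → inverse a c ℚ.* M c b)

      M*inverse≡δ-below : ∀ a c → lev c < n → ∑< n (λ e → M a e ℚ.* inverse e c) ≡ δ a c 1ℚ
      M*inverse≡δ-below a c c<n = trans
        (sym (∑<-extend (suc (lev c)) n _ c<n (λ e c<e _ → trans
          (cong (M a e ℚ.*_) (upperTriangular-zero inverse-upperTriangular e c (λ { refl → ℕP.<-irrefl refl c<e })
                                                   (λ e<c → ℕP.<-asym e<c c<e)))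
          (ℚP.*-zeroʳ (M a e)))))
        (M*inverse a c)

      M*X≡M[b] : ∀ a → ∑< n (λ e → M a e ℚ.* X e) ≡ M a b
      M*X≡M[b] a = begin
          ∑< n (λ e → M a e ℚ.* X e)
        ≡⟨ ∑<-cong n (λ e _ → sym (∑<-*ˡ n (M a e) _)) ⟩
          ∑< n (λ e → ∑< n (λ c → M a e ℚ.* (inverse e c ℚ.* M c b)))
        ≡⟨ ∑<-swap n n _ ⟩
          ∑< n (λ c → ∑< n (λ e → M a e ℚ.* (inverse e c ℚ.* M c b)))
        ≡⟨ ∑<-cong n (λ c _ → trans (∑<-cong n (λ e _ → sym (ℚP.*-assoc (M a e) _ _))) (∑<-*ʳ n _ (M c b))) ⟩
          ∑< n (λ c → ∑< n (λ e → M a e ℚ.* inverse e c) ℚ.* M c b)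
        ≡⟨ ∑<-cong n (λ c c<n → cong (ℚ._* M c b) (M*inverse≡δ-below a c c<n)) ⟩
          ∑< n (λ c → δ a c 1ℚ ℚ.* M c b)
        ≡⟨ pick-row ⟩
          M a b
        ∎
        where
        open ≡-Reasoning
        δ*M : ∀ c → c ≢ a → δ a c 1ℚ ℚ.* M c b ≡ 0ℚ
        δ*M c c≢a = trans (cong (ℚ._* M c b) (δ-diff a c 1ℚ (c≢a ∘ sym))) (ℚP.*-zeroˡ (M c b))
        pick-row : ∑< n (λ c → δ a c 1ℚ ℚ.* M c b) ≡ M a b
        pick-row with lev a ℕ.<? n
        ... | yes a<n = trans (∑<-δ n _ a (λ c _ → δ*M c) a<n)
                              (trans (cong (ℚ._* M a b) (δ-same a 1ℚ)) (ℚP.*-identityˡ (M a b)))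
        ... | no  a≮n = trans (∑<-zero n _ (λ c c<n → δ*M c (λ { refl → a≮n c<n })))
                              (sym (upperTriangular-zero ut a b (λ { refl → a≮n (ℕP.n<1+n (lev b)) })
                                                            (λ a<b → a≮n (ℕP.<-trans a<b (ℕP.n<1+n (lev b))))))

      X-step : ∀ a → lev a ≤ lev b → (∀ e → lev a < lev e → lev e ≤ lev b → X e ≡ δ e b 1ℚ) → X a ≡ δ a b 1ℚ
      X-step a a≤b above = pivot-injective (M a a) (pivot⁻¹ a) (X a) (δ a b 1ℚ) (M a b) (pivot*pivot⁻¹ a) (begin
          M a b
        ≡⟨ sym (M*X≡M[b] a) ⟩
          ∑< n (λ e → M a e ℚ.* X e)
        ≡⟨ ∑<-split n _ (λ e → M a e ℚ.* δ e b 1ℚ) a agree (s≤s a≤b) ⟩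
          ∑< n (λ e → M a e ℚ.* δ e b 1ℚ) ℚ.+ (M a a ℚ.* X a ℚ.- M a a ℚ.* δ a b 1ℚ)
        ≡⟨ cong (ℚ._+ (M a a ℚ.* X a ℚ.- M a a ℚ.* δ a b 1ℚ)) M[b] ⟩
          M a b ℚ.+ (M a a ℚ.* X a ℚ.- M a a ℚ.* δ a b 1ℚ)
        ∎)
        where
        open ≡-Reasoning
        agree : ∀ e → lev e < n → e ≢ a → M a e ℚ.* X e ≡ M a e ℚ.* δ e b 1ℚ
        agree e e<n e≢a = M*-cong-aboveDiagonal e≢a λ a<e → above e a<e (ℕP.≤-pred e<n)
        M[b] : ∑< n (λ e → M a e ℚ.* δ e b 1ℚ) ≡ M a b
        M[b] = trans (∑<-δ n _ b (λ e _ e≢b → trans (cong (M a e ℚ.*_) (δ-diff e b 1ℚ e≢b)) (ℚP.*-zeroʳ (M a e)))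
                           (ℕP.n<1+n (lev b)))
                     (trans (cong (M a b ℚ.*_) (δ-same b 1ℚ)) (ℚP.*-identityʳ (M a b)))

      X-descending : ∀ k a → lev a ≤ lev b → lev b ≤ lev a + k → X a ≡ δ a b 1ℚ
      X-descending zero    a a≤b b≤a+0 = X-step a a≤b (λ e a<e e≤b → ⊥-elim (ℕP.<-irrefl refl
        (ℕP.<-≤-trans a<e (ℕP.≤-trans e≤b (ℕP.≤-trans b≤a+0 (ℕP.≤-reflexive (ℕP.+-identityʳ (lev a))))))))
      X-descending (suc k) a a≤b b≤a+1+k = X-step a a≤b (λ e a<e e≤b → X-descending k e e≤b
        (ℕP.≤-trans b≤a+1+k (ℕP.≤-trans (ℕP.≤-reflexive (ℕP.+-suc (lev a) k)) (ℕP.+-monoˡ-≤ k a<e))))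

      X≡δ : ∀ a → X a ≡ δ a b 1ℚ
      X≡δ a with lev a ℕ.≤? lev b
      ... | yes a≤b = X-descending (lev b) a a≤b (ℕP.m≤n+m (lev b) (lev a))
      ... | no  a≰b = trans (∑<-zero n _ (λ c c<n → trans (cong (ℚ._* M c b)
                              (upperTriangular-zero inverse-upperTriangular a c (λ { refl → a≰b (ℕP.≤-pred c<n) })
                                                    (λ a<c → a≰b (ℕP.≤-trans (ℕP.<⇒≤ a<c) (ℕP.≤-pred c<n)))))
                              (ℚP.*-zeroˡ (M c b))))
                            (sym (δ-diff a b 1ℚ (λ { refl → a≰b ℕP.≤-refl })))

    isIdentity : (X : Index R → Index R → ℚ) → (∀ a b → X a b ≡ δ a b 1ℚ) → IsIdentity R X
    isIdentity X X≡δ = (λ a → trans (X≡δ a a) (δ-same a 1ℚ))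
                     , (λ a b a≢b → trans (X≡δ a b) (δ-diff a b 1ℚ a≢b))

    invertible : Invertible R M
    invertible = inverse , inverse-upperTriangular
               , isIdentity (mul R M inverse) (λ a b → trans (sumBelow≡∑< R (suc (lev b)) _) (M*inverse a b))
               , isIdentity (mul R inverse M) (λ a b → trans (sumBelow≡∑< R (suc (lev b)) _) (LeftInverse.X≡δ b a))

module _ (R : RepSystem) where

  LA-diagonal≢0 : ∀ a → LA R a a ≢ 0ℚ
  LA-diagonal≢0 a LA≡0 =
    countᴱ-pos (Maps A A) (leafAddᵇ A A) (leafAddᵇ-resp A A) (id , id) (isLeafAddInHom⁺ A A id id (id-isLeafAddInHom A))
               (trans (sym (LeafAddInHom≡countᴱ A A)) (toℚ≡0⇒≡0 _ LA≡0))
    where A = rep R a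

  LA-upperTriangular : UpperTriangular R (LA R)
  LA-upperTriangular a b LA≢0 =
    Sum.map (λ iso → rep-injective R a b (gV , gE , isIso⁺ A B gV gE iso))
            (subst₂ _<_ (reps-size R _ _) (reps-size R _ _))
            (isIsomorphism-or-size< (isLeafAddInHom⁻ A B gV gE (proj₂ found)))
    where
    A = rep R a
    B = rep R b
    found = countᴱ≢0⇒∃ (Maps A B) (leafAddᵇ A B)
              (λ count≡0 → LA≢0 (cong toℚ (trans (LeafAddInHom≡countᴱ A B) count≡0)))
    gV = proj₁ (proj₁ found)
    gE = proj₂ (proj₁ found)

lemma6 : (R : RepSystem) →
    ((G H : Hypergraph) → Connected G →
    Σ ℕ λ N → ((a : Index R) → N ≤ level {R} a → term R G H a ≡ 0ℚ)
    × (toℚ (LoInjInHom G H) ≡ sumBelow R N (term R G H)))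
    × UpperTriangular R (LA R)
    × Invertible R (LA R)
lemma6 R = (λ G H G-conn → let open MainIdentity R G H G-conn in levelBound G H , term-vanishes , identity)
         , LA-upperTriangular R
         , UpperTriangularInverse.invertible R (LA R) (LA-upperTriangular R) (LA-diagonal≢0 R)
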